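{- Let $n\geq 0$ and let $L_{n+3}=L_{3,n}$ be the lariat graph. Expand $X_{L_{n+3}}$ and $X_{P_{n+3}}$ in the basis $\{e_\lambda\}$ of elementary symmetric functions. Then: (1) If $e_\lambda$ appears in $X_{L_{n+3}}$ with nonzero coefficient, then $e_\lambda$ appears in $X_{P_{n+3}}$ with nonzero coefficient. (2) If $\lambda$ is a partition with no part equal to $2$ and $e_\lambda$ appears in $X_{P_{n+3}}$ with coefficient $c_\lambda$, then $e_\lambda$ appears in $X_{L_{n+3}}$ with coefficient $2c_\lambda$. (3) The coefficient of $e_{(n+1,2)}$ in $X_{L_{n+3}}$ is $4n$. (4) The coefficient of $e_{(n,2,1)}$ in $X_{L_{n+3}}$ is $2(n-1)$. (5) The coefficient of $e_{(n-1,2,2)}$ in $X_{L_{n+3}}$ is $4(n-2)$.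
   Context: All graphs are finite and simple. For a graph $G$ with vertex set $\{v_1,\dots,v_N\}$, the chromatic symmetric function is $X_G=\sum_\kappa x_{\kappa(v_1)}\cdots x_{\kappa(v_N)}$, summed over all proper colourings $\kappa:V\to\{1,2,\dots\}$. $K_m$ is the complete graph on $m$ vertices, $P_n$ the path on $n$ vertices. For $m,n\geq1$ the lollipop graph $L_{m,n}$ is obtained from the disjoint union of $K_m$ and $P_n$ by adding an edge joining a vertex of $K_m$ to an end vertex of $P_n$, and $L_{m,0}=K_m$. The lariat graph is $L_{n+3}:=L_{3,n}$ for $n\geq0$ (a triangle with a path of $n$ vertices attached). For a partition $\lambda=(\lambda_1,\dots,\lambda_\ell)$, $e_\lambda=e_{\lambda_1}\cdots e_{\lambda_\ell}$ with $e_i$ the $i$-th elementary symmetric function; the $e_\lambda$ form a basis of the symmetric functions. A partition written with a part that is not positive (as in items (3)–(5) for small $n$) is understood with its nonpositive parts removed/coefficient interpreted accordingly. -}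

module Defs where

open import Data.Bool using (Bool; true; false; _∧_; _∨_; not; if_then_else_)
open import Data.Nat using (ℕ; zero; suc; _+_; _∸_; _⊓_; _≡ᵇ_; _<ᵇ_; _≤_)
open import Data.Fin using (Fin; toℕ)
open import Data.List using (List; []; _∷_; [_]; map; concatMap; filter; length; upTo; allFin; foldr)
import Data.List as List
open import Data.List.Relation.Unary.All using (All)
open import Data.List.Relation.Unary.Linked using (Linked)
open import Data.Vec.Functional using (Vector) renaming (_∷_ to _∷ᶠ_)
open import Data.Integer using (ℤ; +_) renaming (_+_ to _+ℤ_; _*_ to _*ℤ_)
open import Relation.Binary.PropositionalEquality using (_≡_)
open import Relation.Nullary.Decidable using (⌊_⌋)
import Data.Fin as Fin

-- Finite simple graphs on the vertex set Fin N, given by a Boolean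
-- adjacency function (the specific graphs below are symmetric and
-- irreflexive).

Graph : ℕ → Set
Graph N = Fin N → Fin N → Bool

-- Lollipop L_{m,n} on vertices 0,…,m+n-1: vertices 0..m-1 form K_m,
-- vertices m-1, m, …, m+n-1 form a path (so m-1 is the vertex of K_m
-- joined to the end vertex m of P_n).
lollipop : (m n : ℕ) → Graph (m + n)
lollipop m n i j =
  (not (toℕ i ≡ᵇ toℕ j) ∧ (toℕ i <ᵇ m) ∧ (toℕ j <ᵇ m))
  ∨ (suc (toℕ i) ≡ᵇ toℕ j) ∨ (suc (toℕ j) ≡ᵇ toℕ i)

lariat : (n : ℕ) → Graph (3 + n)
lariat n = lollipop 3 n

pathGraph : (N : ℕ) → Graph N
pathGraph N i j = (suc (toℕ i) ≡ᵇ toℕ j) ∨ (suc (toℕ j) ≡ᵇ toℕ i)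

allFunsL : {A : Set} → List A → (n : ℕ) → List (Vector A n)
allFunsL xs zero    = [ (λ ()) ]
allFunsL xs (suc n) = concatMap (λ f → map (λ x → x ∷ᶠ f) xs) (allFunsL xs n)

countFin : {n : ℕ} → (Fin n → Bool) → ℕ
countFin {n} p = length (filter (λ i → p i Data.Bool.≟ true) (allFin n))

andFin : {n : ℕ} → (Fin n → Bool) → Bool
andFin {n} p = foldr (λ i b → p i ∧ b) true (allFin n)

sumℕ : List ℕ → ℕ
sumℕ = foldr _+_ 0

sumℤ : List ℤ → ℤ
sumℤ = foldr _+ℤ_ (+ 0)

_=ᶠ_ : {N : ℕ} → Fin N → Fin N → Bool
a =ᶠ b = ⌊ a Fin.≟ b ⌋

-- Chromatic symmetric function.  A homogeneous symmetric function of
-- degree N is determined by its restriction to N variables x_0,…,x_{N-1};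
-- an exponent vector is α : Fin N → ℕ.

properB : {N : ℕ} → Graph N → (Fin N → Fin N) → Bool
properB G κ = andFin (λ u → andFin (λ v → not (G u v) ∨ not (κ u =ᶠ κ v)))

hasExponent : {N : ℕ} → (Fin N → Fin N) → (Fin N → ℕ) → Bool
hasExponent κ α = andFin (λ c → countFin (λ v → κ v =ᶠ c) ≡ᵇ α c)

XCoeff : {N : ℕ} → Graph N → (Fin N → ℕ) → ℕ
XCoeff {N} G α =
  length (filter (λ κ → (properB G κ ∧ hasExponent κ α) Data.Bool.≟ true)
                 (allFunsL (allFin N) N))

-- Elementary symmetric functions.  e_k = Σ_{|S| = k} x^S, and
-- e_λ = e_{λ₁} ⋯ e_{λ_ℓ}; eCoeff λ α is the coefficient of x^α in e_λ
-- (in the variables x_0,…,x_{N-1}), computed by expanding the product.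

subsets : (N : ℕ) → List (Fin N → Bool)
subsets N = allFunsL (true ∷ false ∷ []) N

b2n : Bool → ℕ
b2n true  = 1
b2n false = 0

eCoeff : {N : ℕ} → List ℕ → (Fin N → ℕ) → ℕ
eCoeff {N} []      α = if andFin (λ i → α i ≡ᵇ 0) then 1 else 0
eCoeff {N} (k ∷ λs) α =
  sumℕ (map (λ S → eCoeff λs (λ i → α i ∸ b2n (S i)))
            (filter (λ S → ((countFin S ≡ᵇ k) ∧ andFin (λ i → not (S i) ∨ (0 <ᵇ α i)))
                             Data.Bool.≟ true)
                    (subsets N)))

IsPartitionOf : ℕ → List ℕ → Set
IsPartitionOf N λs = (sumℕ λs ≡ N) Data.Product.× All (1 ≤_) λs Data.Product.× Linked (λ a b → b ≤ a) λs
  where import Data.Product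

-- parts fuel n m : all partitions of n with all parts ≤ m (fuel ≥ n)
partsB : ℕ → ℕ → ℕ → List (List ℕ)
partsB _        zero    _ = [ [] ]
partsB zero     (suc n) _ = []
partsB (suc f)  (suc n) m =
  concatMap (λ k → map (k ∷_) (partsB f (suc n ∸ k) k)) (map suc (upTo (suc n ⊓ m)))

partitions : ℕ → List (List ℕ)
partitions N = partsB N N N

IsEExpansion : {N : ℕ} → Graph N → (List ℕ → ℤ) → Set
IsEExpansion {N} G c =
  (α : Fin N → ℕ) → + XCoeff G α ≡ sumℤ (map (λ λs → c λs *ℤ + eCoeff λs α) (partitions N))

{-# OPTIONS --safe #-}
module Submission where

-- Proper colourings of the path P_N are the Smirnov words (no two equal adjacent letters) of
-- length N, and those of the lariat L_{n+3} are the Smirnov words whose first and third letters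
-- differ. Sorting Smirnov words by their first letter gives X_{P_M} = e_M + Σᵢ (i - 1) eᵢ X_{P_{M-i}},
-- and matching the words a b w with the words b a b w′ gives X_L + 2 e₂ X_{P_{n+1}} = 2 X_{P_{n+3}}.
-- The e_λ are linearly independent (e_μ evaluated at the conjugate x^{λ′} is 1 for μ = λ and 0 for
-- μ lexicographically above λ), so c_λ = 2 d_λ - 2 [2 ∈ λ] d′_{λ - 2} with d, d′ the coefficients of
-- X_{P_{n+3}}, X_{P_{n+1}}. By the recursion d_λ ≠ 0 exactly when λ has at most one part 1, which
-- gives (1); (2) is immediate and (3)–(5) are a few evaluations of the recursion.

open import Defs

open import Algebra.Bundles using (CommutativeMonoid; CommutativeSemigroup)
open import Algebra.Structures using (IsCommutativeMonoid)
open import Data.Bool using (Bool; true; false; _∧_; _∨_; not; if_then_else_)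
import Data.Bool as Bool
open import Data.Bool.Properties
  using (T-≡; not-injective; ∧-zeroʳ; ∧-identityʳ; ∨-zeroʳ; ∨-identityʳ; ∧-comm; ⇔→≡; ∧-commutativeMonoid)
open import Data.Bool.Solver using (module ∨-∧-Solver)
open import Data.Empty using (⊥-elim)
open import Data.Fin using (Fin; toℕ) renaming (zero to fzero; suc to fsuc)
import Data.Fin as Fin
open import Data.Fin.Properties using (toℕ-injective)
open import Data.Integer using (ℤ; +_; -_) renaming (_+_ to _+ℤ_; _*_ to _*ℤ_)
import Data.Integer.Properties as ℤ
import Data.Integer.Solver as ℤ-Solver
open import Data.List using (List; []; _∷_; map; concatMap; filter; length; foldr; _++_; allFin; applyDownFrom; upTo)
open import Data.List.Membership.Propositional using (_∈_; _∉_)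
open import Data.List.Properties using (map-tabulate; map-applyUpTo; foldr-map; ≡-dec; filter-notAll)
open import Data.List.Relation.Binary.Lex.Strict using (Lex-≤; base; halt; this; next)
  renaming (≤-total to lex-total; ≤-transitive to lex-transitive)
open import Data.List.Relation.Unary.All using (All; []; _∷_)
import Data.List.Relation.Unary.All as All
import Data.List.Relation.Unary.All.Properties as All
open import Data.List.Relation.Unary.Any using (Any; here; there)
import Data.List.Relation.Unary.Any as Any
open import Data.List.Relation.Unary.Linked using (Linked; []; [-]; _∷_)
open import Data.Maybe using (Maybe; just; nothing)
open import Data.Nat using (ℕ; zero; suc; _+_; _*_; _∸_; _≤_; _<_; z≤n; s≤s; _≡ᵇ_; _<ᵇ_; _≤ᵇ_; _⊓_)
open import Data.Nat.Properties
open import Data.Nat.Solver using (module +-*-Solver)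
open import Data.Product using (_×_; _,_; proj₁; proj₂)
open import Data.Sum using (_⊎_; inj₁; inj₂)
open import Data.Vec.Functional using () renaming (_∷_ to _∷ᶠ_)
open import Function using (_∘_; id; Equivalence; mk⇔)
open import Level using (0ℓ)
open import Relation.Binary.Definitions using (DecidableEquality)
open import Relation.Binary.PropositionalEquality
open import Relation.Nullary using (Dec; yes; no; does; ¬?)
open import Relation.Nullary.Decidable using (dec-true; dec-false)

open import Algebra.Properties.CommutativeSemigroup (CommutativeMonoid.commutativeSemigroup ∧-commutativeMonoid)
  using () renaming (interchange to ∧-interchange)

-- Finite sums

module ListSum {A : Set} {_⊕_ : A → A → A} {ε : A}
               (isCommutativeMonoid : IsCommutativeMonoid _≡_ _⊕_ ε) where

  open IsCommutativeMonoid isCommutativeMonoid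
    using (assoc; identityˡ; isCommutativeSemigroup)

  private
    commutativeSemigroup : CommutativeSemigroup 0ℓ 0ℓ
    commutativeSemigroup = record
      { Carrier = A ; _≈_ = _≡_ ; _∙_ = _⊕_ ; isCommutativeSemigroup = isCommutativeSemigroup }

  open import Algebra.Properties.CommutativeSemigroup commutativeSemigroup using (interchange)

  ∑ : {X : Set} → List X → (X → A) → A
  ∑ xs f = foldr _⊕_ ε (map f xs)

  when : Bool → A → A
  when b a = if b then a else ε

  ∑-cong : {X : Set} (xs : List X) {f g : X → A} → f ≗ g → ∑ xs f ≡ ∑ xs g
  ∑-cong []       f≗g = refl
  ∑-cong (x ∷ xs) f≗g = cong₂ _⊕_ (f≗g x) (∑-cong xs f≗g)

  ∑-distrib : {X : Set} (xs : List X) (f g : X → A) → ∑ xs (λ x → f x ⊕ g x) ≡ ∑ xs f ⊕ ∑ xs g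
  ∑-distrib []       f g = sym (identityˡ ε)
  ∑-distrib (x ∷ xs) f g = trans (cong ((f x ⊕ g x) ⊕_) (∑-distrib xs f g)) (interchange (f x) (g x) _ _)

  ∑-ε : {X : Set} (xs : List X) → ∑ xs (λ _ → ε) ≡ ε
  ∑-ε []       = refl
  ∑-ε (x ∷ xs) = trans (identityˡ _) (∑-ε xs)

  ∑-++ : {X : Set} (xs ys : List X) (f : X → A) → ∑ (xs ++ ys) f ≡ ∑ xs f ⊕ ∑ ys f
  ∑-++ []       ys f = sym (identityˡ _)
  ∑-++ (x ∷ xs) ys f = trans (cong (f x ⊕_) (∑-++ xs ys f)) (sym (assoc _ _ _))

  ∑-map : {X Y : Set} (xs : List X) (g : X → Y) (f : Y → A) → ∑ (map g xs) f ≡ ∑ xs (f ∘ g)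
  ∑-map []       g f = refl
  ∑-map (x ∷ xs) g f = cong (f (g x) ⊕_) (∑-map xs g f)

  ∑-concatMap : {X Y : Set} (xs : List X) (g : X → List Y) (f : Y → A) →
                ∑ (concatMap g xs) f ≡ ∑ xs (λ x → ∑ (g x) f)
  ∑-concatMap []       g f = refl
  ∑-concatMap (x ∷ xs) g f = trans (∑-++ (g x) (concatMap g xs) f) (cong (∑ (g x) f ⊕_) (∑-concatMap xs g f))

  ∑-comm : {X Y : Set} (xs : List X) (ys : List Y) (f : X → Y → A) →
           ∑ xs (λ x → ∑ ys (f x)) ≡ ∑ ys (λ y → ∑ xs (λ x → f x y))
  ∑-comm []       ys f = sym (∑-ε ys)
  ∑-comm (x ∷ xs) ys f = trans (cong (∑ ys (f x) ⊕_) (∑-comm xs ys f)) (sym (∑-distrib ys (f x) _))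

  ∑-filter : {X : Set} (xs : List X) (p : X → Bool) (f : X → A) →
             foldr _⊕_ ε (map f (filter (λ x → p x Bool.≟ true) xs)) ≡ ∑ xs (λ x → when (p x) (f x))
  ∑-filter []       p f = refl
  ∑-filter (x ∷ xs) p f with p x
  ... | true  = cong (f x ⊕_) (∑-filter xs p f)
  ... | false = trans (∑-filter xs p f) (sym (identityˡ _))

  ∑-when : {X : Set} (xs : List X) (b : Bool) (f : X → A) → ∑ xs (λ x → when b (f x)) ≡ when b (∑ xs f)
  ∑-when xs true  f = refl
  ∑-when xs false f = ∑-ε xs

  when-∧ : ∀ b c a → when (b ∧ c) a ≡ when b (when c a)
  when-∧ true  c a = refl
  when-∧ false c a = refl

  when-comm : ∀ b c a → when b (when c a) ≡ when c (when b a)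
  when-comm true  true  a = refl
  when-comm true  false a = refl
  when-comm false true  a = refl
  when-comm false false a = refl

  when-ε : ∀ b → when b ε ≡ ε
  when-ε true  = refl
  when-ε false = refl

  when-distrib : ∀ b x y → when b (x ⊕ y) ≡ when b x ⊕ when b y
  when-distrib true  x y = refl
  when-distrib false x y = sym (identityˡ ε)

open ListSum +-0-isCommutativeMonoid public
module ∑ℤ = ListSum ℤ.+-0-isCommutativeMonoid

length-filter : {X : Set} (xs : List X) (p : X → Bool) →
                length (filter (λ x → p x Bool.≟ true) xs) ≡ ∑ xs (λ x → when (p x) 1)
length-filter []       p = refl
length-filter (x ∷ xs) p with p x
... | true  = cong suc (length-filter xs p)
... | false = length-filter xs p

*-distribˡ-∑ : {X : Set} (xs : List X) (k : ℕ) (f : X → ℕ) → ∑ xs (λ x → k * f x) ≡ k * ∑ xs f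
*-distribˡ-∑ []       k f = sym (*-zeroʳ k)
*-distribˡ-∑ (x ∷ xs) k f = trans (cong (_+_ (k * f x)) (*-distribˡ-∑ xs k f)) (sym (*-distribˡ-+ k (f x) _))

*-when : ∀ a b x → a * when b x ≡ when b (a * x)
*-when a true  x = refl
*-when a false x = *-zeroʳ a

∑-mono-≤ : {X : Set} (xs : List X) {f g : X → ℕ} → (∀ x → f x ≤ g x) → ∑ xs f ≤ ∑ xs g
∑-mono-≤ []       f≤g = z≤n
∑-mono-≤ (x ∷ xs) f≤g = +-mono-≤ (f≤g x) (∑-mono-≤ xs f≤g)

pos-∑ : {X : Set} (xs : List X) (f : X → ℕ) → ∑ℤ.∑ xs (λ x → + f x) ≡ + ∑ xs f
pos-∑ []       f = refl
pos-∑ (x ∷ xs) f = trans (cong (_+ℤ_ (+ f x)) (pos-∑ xs f)) (sym (ℤ.pos-+ (f x) _))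

neg-distrib-∑ : {X : Set} (xs : List X) (f : X → ℤ) → ∑ℤ.∑ xs (λ x → - f x) ≡ - ∑ℤ.∑ xs f
neg-distrib-∑ []       f = refl
neg-distrib-∑ (x ∷ xs) f = trans (cong (_+ℤ_ (- f x)) (neg-distrib-∑ xs f)) (sym (ℤ.neg-distrib-+ (f x) _))

∧-trueˡ : ∀ {a b} → (a ∧ b) ≡ true → a ≡ true
∧-trueˡ {true} _ = refl

∧-trueʳ : ∀ {a b} → (a ∧ b) ≡ true → b ≡ true
∧-trueʳ {true} e = e

∧-true : ∀ {a b} → a ≡ true → b ≡ true → (a ∧ b) ≡ true
∧-true refl refl = refl

true≢false : true ≢ false
true≢false ()

≡ᵇ-true⇒≡ : ∀ m n → (m ≡ᵇ n) ≡ true → m ≡ n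
≡ᵇ-true⇒≡ m n e = ≡ᵇ⇒≡ m n (Equivalence.from T-≡ e)

≡⇒≡ᵇ-true : ∀ m n → m ≡ n → (m ≡ᵇ n) ≡ true
≡⇒≡ᵇ-true m n e = Equivalence.to T-≡ (≡⇒≡ᵇ m n e)

≢⇒≡ᵇ-false : ∀ m n → m ≢ n → (m ≡ᵇ n) ≡ false
≢⇒≡ᵇ-false m n m≢n with m ≡ᵇ n in e
... | true  = ⊥-elim (m≢n (≡ᵇ-true⇒≡ m n e))
... | false = refl

≡ᵇ-refl : ∀ n → (n ≡ᵇ n) ≡ true
≡ᵇ-refl n = ≡⇒≡ᵇ-true n n refl

<ᵇ-true⇒< : ∀ m n → (m <ᵇ n) ≡ true → m < n
<ᵇ-true⇒< m n e = <ᵇ⇒< m n (Equivalence.from T-≡ e)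

<⇒<ᵇ-true : ∀ m n → m < n → (m <ᵇ n) ≡ true
<⇒<ᵇ-true m n m<n = Equivalence.to T-≡ (<⇒<ᵇ m<n)

≤⇒>ᵇ-false : ∀ m n → m ≤ n → (n <ᵇ m) ≡ false
≤⇒>ᵇ-false m n m≤n with n <ᵇ m in e
... | true  = ⊥-elim (<⇒≱ (<ᵇ-true⇒< n m e) m≤n)
... | false = refl

≤ᵇ-true⇒≤ : ∀ m n → (m ≤ᵇ n) ≡ true → m ≤ n
≤ᵇ-true⇒≤ m n e = ≤ᵇ⇒≤ m n (Equivalence.from T-≡ e)

≤⇒≤ᵇ-true : ∀ m n → m ≤ n → (m ≤ᵇ n) ≡ true
≤⇒≤ᵇ-true m n m≤n = Equivalence.to T-≡ (≤⇒≤ᵇ m≤n)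

≤ᵇ-false⇒> : ∀ m n → (m ≤ᵇ n) ≡ false → n < m
≤ᵇ-false⇒> m n e = ≰⇒> (λ m≤n → true≢false (trans (sym (≤⇒≤ᵇ-true m n m≤n)) e))

>⇒≤ᵇ-false : ∀ m n → n < m → (m ≤ᵇ n) ≡ false
>⇒≤ᵇ-false m n n<m with m ≤ᵇ n in e
... | true  = ⊥-elim (<⇒≱ n<m (≤ᵇ-true⇒≤ m n e))
... | false = refl

=ᶠ-true⇒≡ : ∀ {n} (a b : Fin n) → (a =ᶠ b) ≡ true → a ≡ b
=ᶠ-true⇒≡ a b e with a Fin.≟ b
... | yes a≡b = a≡b

=ᶠ-refl : ∀ {n} (a : Fin n) → (a =ᶠ a) ≡ true
=ᶠ-refl a with a Fin.≟ a
... | yes _   = refl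
... | no  a≢a = ⊥-elim (a≢a refl)

≢⇒=ᶠ-false : ∀ {n} (a b : Fin n) → a ≢ b → (a =ᶠ b) ≡ false
≢⇒=ᶠ-false a b a≢b with a Fin.≟ b
... | yes a≡b = ⊥-elim (a≢b a≡b)
... | no  _   = refl

=ᶠ-sym : ∀ {n} (a b : Fin n) → (a =ᶠ b) ≡ (b =ᶠ a)
=ᶠ-sym a b = ⇔→≡ (mk⇔ (λ e → subst (λ c → (b =ᶠ c) ≡ true) (sym (=ᶠ-true⇒≡ a b e)) (=ᶠ-refl b))
                      (λ e → subst (λ c → (a =ᶠ c) ≡ true) (sym (=ᶠ-true⇒≡ b a e)) (=ᶠ-refl a)))

=ᶠ-suc : ∀ {n} (a b : Fin n) → (fsuc a =ᶠ fsuc b) ≡ (a =ᶠ b)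
=ᶠ-suc a b with a Fin.≟ b
... | yes _ = refl
... | no  _ = refl

allFin-suc : ∀ n → allFin (suc n) ≡ fzero ∷ map fsuc (allFin n)
allFin-suc n = cong (fzero ∷_) (sym (map-tabulate id fsuc))

∑-allFin-suc : ∀ n (h : Fin (suc n) → ℕ) → ∑ (allFin (suc n)) h ≡ h fzero + ∑ (allFin n) (h ∘ fsuc)
∑-allFin-suc n h = trans (cong (λ xs → ∑ xs h) (allFin-suc n)) (cong (_+_ (h fzero)) (∑-map (allFin n) fsuc h))

andFin-suc : ∀ n (p : Fin (suc n) → Bool) → andFin p ≡ (p fzero ∧ andFin (p ∘ fsuc))
andFin-suc n p = trans (cong (foldr (λ i b → p i ∧ b) true) (allFin-suc n))
                       (cong (p fzero ∧_) (foldr-map _ fsuc true (allFin n)))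

andFin-true⇒ : ∀ n (p : Fin n → Bool) → andFin p ≡ true → ∀ i → p i ≡ true
andFin-true⇒ (suc n) p e fzero    = ∧-trueˡ (trans (sym (andFin-suc n p)) e)
andFin-true⇒ (suc n) p e (fsuc i) = andFin-true⇒ n (p ∘ fsuc) (∧-trueʳ (trans (sym (andFin-suc n p)) e)) i

⇒andFin-true : ∀ n (p : Fin n → Bool) → (∀ i → p i ≡ true) → andFin p ≡ true
⇒andFin-true zero    p h = refl
⇒andFin-true (suc n) p h = trans (andFin-suc n p) (∧-true (h fzero) (⇒andFin-true n (p ∘ fsuc) (h ∘ fsuc)))

andFin-cong : ∀ n {p q : Fin n → Bool} → p ≗ q → andFin p ≡ andFin q
andFin-cong n {p} {q} p≗q = ⇔→≡ (mk⇔
  (λ h → ⇒andFin-true n q (λ i → trans (sym (p≗q i)) (andFin-true⇒ n p h i)))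
  (λ h → ⇒andFin-true n p (λ i → trans (p≗q i) (andFin-true⇒ n q h i))))

andFin-∧ : ∀ n (p q : Fin n → Bool) → (andFin p ∧ andFin q) ≡ andFin (λ i → p i ∧ q i)
andFin-∧ n p q = ⇔→≡ (mk⇔
  (λ h → ⇒andFin-true n _ (λ i → ∧-true (andFin-true⇒ n p (∧-trueˡ h) i) (andFin-true⇒ n q (∧-trueʳ {andFin p} h) i)))
  (λ h → ∧-true (⇒andFin-true n p (λ i → ∧-trueˡ (andFin-true⇒ n _ h i)))
                (⇒andFin-true n q (λ i → ∧-trueʳ {p i} (andFin-true⇒ n _ h i)))))

countFin≡∑ : ∀ n (p : Fin n → Bool) → countFin p ≡ ∑ (allFin n) (λ i → when (p i) 1)
countFin≡∑ n p = length-filter (allFin n) p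

countFin-cong : ∀ n {p q : Fin n → Bool} → p ≗ q → countFin p ≡ countFin q
countFin-cong n {p} {q} p≗q =
  trans (countFin≡∑ n p) (trans (∑-cong (allFin n) (λ i → cong (λ b → when b 1) (p≗q i))) (sym (countFin≡∑ n q)))

countFin-suc : ∀ n (p : Fin (suc n) → Bool) → countFin p ≡ when (p fzero) 1 + countFin (p ∘ fsuc)
countFin-suc n p = trans (countFin≡∑ (suc n) p)
  (trans (∑-allFin-suc n (λ i → when (p i) 1)) (cong (_+_ (when (p fzero) 1)) (sym (countFin≡∑ n (p ∘ fsuc)))))

∑-δ : ∀ K (j : Fin K) (h : Fin K → ℕ) → ∑ (allFin K) (λ i → when (j =ᶠ i) (h i)) ≡ h j
∑-δ (suc K) fzero h =
  trans (∑-allFin-suc K (λ i → when (fzero =ᶠ i) (h i))) (trans (cong (_+_ (h fzero)) (∑-ε (allFin K))) (+-identityʳ _))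
∑-δ (suc K) (fsuc j) h =
  trans (∑-allFin-suc K (λ i → when (fsuc j =ᶠ i) (h i)))
        (trans (∑-cong (allFin K) (λ i → cong (λ b → when b (h (fsuc i))) (=ᶠ-suc j i))) (∑-δ K j (h ∘ fsuc)))

∑-indicator : ∀ K (S : Fin K → Bool) (x : ℕ) → ∑ (allFin K) (λ j → when (S j) x) ≡ countFin S * x
∑-indicator K S x = begin
  ∑ (allFin K) (λ j → when (S j) x)     ≡⟨ ∑-cong (allFin K) (λ j → trans (*-when x (S j) 1) (cong (when (S j)) (*-identityʳ x))) ⟨
  ∑ (allFin K) (λ j → x * when (S j) 1) ≡⟨ *-distribˡ-∑ (allFin K) x _ ⟩
  x * ∑ (allFin K) (λ j → when (S j) 1) ≡⟨ cong (x *_) (sym (countFin≡∑ K S)) ⟩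
  x * countFin S                        ≡⟨ *-comm x _ ⟩
  countFin S * x                        ∎
  where open ≡-Reasoning

-- Smirnov words and proper colourings

module _ {K : ℕ} where

  δ : Fin K → Fin K → ℕ
  δ x c = when (x =ᶠ c) 1

  infixl 6 _∸[_]
  _∸[_] : (Fin K → ℕ) → Fin K → (Fin K → ℕ)
  (β ∸[ x ]) c = β c ∸ δ x c

  ∸[]-cong : ∀ {β γ : Fin K → ℕ} x → β ≗ γ → β ∸[ x ] ≗ γ ∸[ x ]
  ∸[]-cong x β≗γ c = cong (_∸ δ x c) (β≗γ c)

  δ-self : ∀ x → δ x x ≡ 1
  δ-self x rewrite =ᶠ-refl x = refl

  δ≤ : (β : Fin K → ℕ) → ∀ x c → (0 <ᵇ β x) ≡ true → δ x c ≤ β c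
  δ≤ β x c h with x =ᶠ c in e
  ... | false = z≤n
  ... | true rewrite sym (=ᶠ-true⇒≡ x c e) = <ᵇ-true⇒< 0 (β x) h

  multiplicity : ∀ {M} → (Fin M → Fin K) → Fin K → ℕ
  multiplicity f c = countFin (λ v → f v =ᶠ c)

  hasContent : ∀ {M} → (Fin M → Fin K) → (Fin K → ℕ) → Bool
  hasContent f β = andFin (λ c → multiplicity f c ≡ᵇ β c)

  multiplicity-∷ : ∀ {M} x (f : Fin M → Fin K) c → multiplicity (x ∷ᶠ f) c ≡ δ x c + multiplicity f c
  multiplicity-∷ {M} x f c = countFin-suc M (λ v → (x ∷ᶠ f) v =ᶠ c)

  hasContent-∷ : ∀ {M} x (f : Fin M → Fin K) β →
                 hasContent (x ∷ᶠ f) β ≡ ((0 <ᵇ β x) ∧ hasContent f (β ∸[ x ]))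
  hasContent-∷ x f β = ⇔→≡ (mk⇔ to from)
    where
    content : hasContent (x ∷ᶠ f) β ≡ true → ∀ c → δ x c + multiplicity f c ≡ β c
    content h c = trans (sym (multiplicity-∷ x f c)) (≡ᵇ-true⇒≡ _ _ (andFin-true⇒ K _ h c))
    to : hasContent (x ∷ᶠ f) β ≡ true → ((0 <ᵇ β x) ∧ hasContent f (β ∸[ x ])) ≡ true
    to h = ∧-true (<⇒<ᵇ-true 0 (β x) (subst (0 <_) (trans (cong (_+ multiplicity f x) (sym (δ-self x))) (content h x)) (s≤s z≤n)))
                  (⇒andFin-true K _ (λ c → ≡⇒≡ᵇ-true _ _ (trans (sym (m+n∸m≡n (δ x c) _)) (cong (_∸ δ x c) (content h c)))))
    from : ((0 <ᵇ β x) ∧ hasContent f (β ∸[ x ])) ≡ true → hasContent (x ∷ᶠ f) β ≡ true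
    from h = ⇒andFin-true K _ (λ c → ≡⇒≡ᵇ-true _ _ (trans (multiplicity-∷ x f c)
               (trans (cong (_+_ (δ x c)) (≡ᵇ-true⇒≡ _ _ (andFin-true⇒ K _ (∧-trueʳ h) c))) (m+[n∸m]≡n (δ≤ β x c (∧-trueˡ h))))))

  avoids : Maybe (Fin K) → Fin K → Bool
  avoids nothing  x = true
  avoids (just p) x = not (p =ᶠ x)

  isSmirnov : ∀ {M} → Maybe (Fin K) → (Fin M → Fin K) → Bool
  isSmirnov {zero}  p f = true
  isSmirnov {suc M} p f = avoids p (f fzero) ∧ isSmirnov (just (f fzero)) (f ∘ fsuc)

  isZero : (Fin K → ℕ) → Bool
  isZero β = andFin (λ c → β c ≡ᵇ 0)

  -- Smirnov words (no two equal adjacent letters) of length M and content β not starting with p.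
  smirnov : ℕ → (Fin K → ℕ) → Maybe (Fin K) → ℕ
  smirnov zero    β p = when (isZero β) 1
  smirnov (suc M) β p = ∑ (allFin K) (λ x → when (avoids p x ∧ (0 <ᵇ β x)) (smirnov M (β ∸[ x ]) (just x)))

  smirnov-cong : ∀ M {β γ} p → β ≗ γ → smirnov M β p ≡ smirnov M γ p
  smirnov-cong zero    p β≗γ = cong (λ b → when b 1) (andFin-cong K (λ c → cong (_≡ᵇ 0) (β≗γ c)))
  smirnov-cong (suc M) p β≗γ = ∑-cong (allFin K) (λ x →
    cong₂ (λ b → when (avoids p x ∧ b)) (cong (0 <ᵇ_) (β≗γ x)) (smirnov-cong M (just x) (∸[]-cong x β≗γ)))

  words : (M : ℕ) → List (Fin M → Fin K)
  words M = allFunsL (allFin K) M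

  ∑-words-suc : ∀ M (g : (Fin (suc M) → Fin K) → ℕ) →
                ∑ (words (suc M)) g ≡ ∑ (allFin K) (λ x → ∑ (words M) (λ f → g (x ∷ᶠ f)))
  ∑-words-suc M g = trans (∑-concatMap (words M) _ g)
    (trans (∑-cong (words M) (λ f → ∑-map (allFin K) _ g)) (∑-comm (words M) (allFin K) _))

  smirnov-count : ∀ M p β → ∑ (words M) (λ f → when (isSmirnov p f ∧ hasContent f β) 1) ≡ smirnov M β p
  smirnov-count zero    p β = trans (+-identityʳ _) (cong (λ b → when b 1) (andFin-cong K (λ c → 0≡ᵇ (β c))))
    where
    0≡ᵇ : ∀ m → (0 ≡ᵇ m) ≡ (m ≡ᵇ 0)
    0≡ᵇ zero    = refl
    0≡ᵇ (suc m) = refl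
  smirnov-count (suc M) p β = trans (∑-words-suc M _) (∑-cong (allFin K) λ x →
    trans (∑-cong (words M) (split x)) (trans (∑-when (words M) _ _)
      (cong (when (avoids p x ∧ (0 <ᵇ β x))) (smirnov-count M (just x) (β ∸[ x ])))))
    where
    split : ∀ x (f : Fin M → Fin K) →
            when ((avoids p x ∧ isSmirnov (just x) f) ∧ hasContent (x ∷ᶠ f) β) 1
            ≡ when (avoids p x ∧ (0 <ᵇ β x)) (when (isSmirnov (just x) f ∧ hasContent f (β ∸[ x ])) 1)
    split x f = begin
      when ((avoids p x ∧ isSmirnov (just x) f) ∧ hasContent (x ∷ᶠ f) β) 1
        ≡⟨ cong (λ b → when ((avoids p x ∧ isSmirnov (just x) f) ∧ b) 1) (hasContent-∷ x f β) ⟩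
      when ((avoids p x ∧ isSmirnov (just x) f) ∧ ((0 <ᵇ β x) ∧ hasContent f (β ∸[ x ]))) 1
        ≡⟨ cong (λ b → when b 1) (∧-interchange (avoids p x) _ _ _) ⟩
      when ((avoids p x ∧ (0 <ᵇ β x)) ∧ (isSmirnov (just x) f ∧ hasContent f (β ∸[ x ]))) 1
        ≡⟨ when-∧ (avoids p x ∧ (0 <ᵇ β x)) _ 1 ⟩
      when (avoids p x ∧ (0 <ᵇ β x)) (when (isSmirnov (just x) f ∧ hasContent f (β ∸[ x ])) 1) ∎
      where open ≡-Reasoning

  AdjacentDistinct : ∀ {M} → (Fin M → Fin K) → Set
  AdjacentDistinct f = ∀ u v → suc (toℕ u) ≡ toℕ v → f u ≢ f v

  isSmirnov⇒adjacentDistinct : ∀ {M} (f : Fin M → Fin K) → isSmirnov nothing f ≡ true → AdjacentDistinct f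
  isSmirnov⇒adjacentDistinct {suc (suc M)} f h fzero (fsuc fzero) refl f₀≡f₁ =
    true≢false (trans (sym (∧-trueˡ h)) (cong not (subst (λ c → (c =ᶠ f (fsuc fzero)) ≡ true) (sym f₀≡f₁) (=ᶠ-refl _))))
  isSmirnov⇒adjacentDistinct {suc (suc M)} f h (fsuc u) (fsuc v) e =
    isSmirnov⇒adjacentDistinct (f ∘ fsuc) (∧-trueʳ h) u v (suc-injective e)

  adjacentDistinct⇒isSmirnov : ∀ {M} (f : Fin M → Fin K) → AdjacentDistinct f → isSmirnov nothing f ≡ true
  adjacentDistinct⇒isSmirnov {zero}        f adj = refl
  adjacentDistinct⇒isSmirnov {suc zero}    f adj = refl
  adjacentDistinct⇒isSmirnov {suc (suc M)} f adj =
    ∧-true (cong not (≢⇒=ᶠ-false _ _ (adj fzero (fsuc fzero) refl)))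
           (adjacentDistinct⇒isSmirnov (f ∘ fsuc) (λ u v e → adj (fsuc u) (fsuc v) (cong suc e)))

properB-true⇒ : ∀ {N} (G : Graph N) κ → properB G κ ≡ true → ∀ u v → G u v ≡ true → κ u ≢ κ v
properB-true⇒ {N} G κ h u v uv κu≡κv = true≢false (begin
  true                              ≡⟨ sym (andFin-true⇒ N _ (andFin-true⇒ N _ h u) v) ⟩
  not (G u v) ∨ not (κ u =ᶠ κ v)    ≡⟨ cong₂ (λ a b → not a ∨ not b) uv (trans (cong (_=ᶠ κ v) κu≡κv) (=ᶠ-refl (κ v))) ⟩
  false                             ∎)
  where open ≡-Reasoning

⇒properB-true : ∀ {N} (G : Graph N) κ → (∀ u v → G u v ≡ true → κ u ≢ κ v) → properB G κ ≡ true
⇒properB-true {N} G κ h = ⇒andFin-true N _ λ u → ⇒andFin-true N _ λ v → edge u v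
  where
  edge : ∀ u v → (not (G u v) ∨ not (κ u =ᶠ κ v)) ≡ true
  edge u v with G u v in uv
  ... | false = refl
  ... | true rewrite ≢⇒=ᶠ-false (κ u) (κ v) (h u v uv) = refl

pathGraph-edge : ∀ {N} (u v : Fin N) → pathGraph N u v ≡ true →
                 suc (toℕ u) ≡ toℕ v ⊎ suc (toℕ v) ≡ toℕ u
pathGraph-edge u v e with suc (toℕ u) ≡ᵇ toℕ v in e₁
... | true  = inj₁ (≡ᵇ-true⇒≡ _ _ e₁)
... | false = inj₂ (≡ᵇ-true⇒≡ _ _ e)

successor-edge : ∀ {N} (G : Graph N) → (∀ u v → pathGraph N u v ≡ true → G u v ≡ true) →
                 ∀ u v → suc (toℕ u) ≡ toℕ v → G u v ≡ true
successor-edge G path⊆G u v e = path⊆G u v (cong (_∨ (suc (toℕ v) ≡ᵇ toℕ u)) (≡⇒≡ᵇ-true _ _ e))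

adjacentDistinct⇒path-edge : ∀ {N K} (κ : Fin N → Fin K) → AdjacentDistinct κ →
                             ∀ u v → suc (toℕ u) ≡ toℕ v ⊎ suc (toℕ v) ≡ toℕ u → κ u ≢ κ v
adjacentDistinct⇒path-edge κ adj u v (inj₁ e) = adj u v e
adjacentDistinct⇒path-edge κ adj u v (inj₂ e) = adj v u e ∘ sym

properB-path : ∀ N (κ : Fin N → Fin N) → properB (pathGraph N) κ ≡ isSmirnov nothing κ
properB-path N κ = ⇔→≡ (mk⇔
  (λ h → adjacentDistinct⇒isSmirnov κ (λ u v e →
           properB-true⇒ (pathGraph N) κ h u v (successor-edge (pathGraph N) (λ _ _ e → e) u v e)))
  (λ h → ⇒properB-true (pathGraph N) κ (λ u v uv →
           adjacentDistinct⇒path-edge κ (isSmirnov⇒adjacentDistinct κ h) u v (pathGraph-edge u v uv))))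

vertex₂ : ∀ {n} → Fin (3 + n)
vertex₂ = fsuc (fsuc fzero)

triangle-edge : ∀ a b → a ≢ b → ((a <ᵇ 3) ∧ (b <ᵇ 3)) ≡ true →
                (suc a ≡ b ⊎ suc b ≡ a) ⊎ (a ≡ 0 × b ≡ 2) ⊎ (a ≡ 2 × b ≡ 0)
triangle-edge 0 0 a≢b _ = ⊥-elim (a≢b refl)
triangle-edge 0 1 _   _ = inj₁ (inj₁ refl)
triangle-edge 0 2 _   _ = inj₂ (inj₁ (refl , refl))
triangle-edge 1 0 _   _ = inj₁ (inj₂ refl)
triangle-edge 1 1 a≢b _ = ⊥-elim (a≢b refl)
triangle-edge 1 2 _   _ = inj₁ (inj₁ refl)
triangle-edge 2 0 _   _ = inj₂ (inj₂ (refl , refl))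
triangle-edge 2 1 _   _ = inj₁ (inj₂ refl)
triangle-edge 2 2 a≢b _ = ⊥-elim (a≢b refl)

lariat-edge : ∀ n (u v : Fin (3 + n)) → lariat n u v ≡ true →
              (suc (toℕ u) ≡ toℕ v ⊎ suc (toℕ v) ≡ toℕ u) ⊎ (u ≡ fzero × v ≡ vertex₂) ⊎ (u ≡ vertex₂ × v ≡ fzero)
lariat-edge n u v e with not (toℕ u ≡ᵇ toℕ v) ∧ ((toℕ u <ᵇ 3) ∧ (toℕ v <ᵇ 3)) in inTriangle
... | false = inj₁ (pathGraph-edge u v e)
... | true with triangle-edge (toℕ u) (toℕ v)
                  (λ u≡v → true≢false (trans (sym (∧-trueˡ inTriangle)) (cong not (≡⇒≡ᵇ-true _ _ u≡v))))
                  (∧-trueʳ {not (toℕ u ≡ᵇ toℕ v)} inTriangle)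
...   | inj₁ path-edge       = inj₁ path-edge
...   | inj₂ (inj₁ (u≡0 , v≡2)) = inj₂ (inj₁ (toℕ-injective u≡0 , toℕ-injective v≡2))
...   | inj₂ (inj₂ (u≡2 , v≡0)) = inj₂ (inj₂ (toℕ-injective u≡2 , toℕ-injective v≡0))

properB-lariat : ∀ n (κ : Fin (3 + n) → Fin (3 + n)) →
                 properB (lariat n) κ ≡ (isSmirnov nothing κ ∧ not (κ fzero =ᶠ κ vertex₂))
properB-lariat n κ = ⇔→≡ (mk⇔ to from)
  where
  path⊆lariat : ∀ u v → pathGraph (3 + n) u v ≡ true → lariat n u v ≡ true
  path⊆lariat u v e = trans (cong (inTriangle ∨_) e) (∨-zeroʳ inTriangle)
    where
    inTriangle : Bool
    inTriangle = not (toℕ u ≡ᵇ toℕ v) ∧ ((toℕ u <ᵇ 3) ∧ (toℕ v <ᵇ 3))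
  to : properB (lariat n) κ ≡ true → (isSmirnov nothing κ ∧ not (κ fzero =ᶠ κ vertex₂)) ≡ true
  to h = ∧-true (adjacentDistinct⇒isSmirnov κ (λ u v e → properB-true⇒ (lariat n) κ h u v (successor-edge (lariat n) path⊆lariat u v e)))
                (cong not (≢⇒=ᶠ-false _ _ (properB-true⇒ (lariat n) κ h fzero vertex₂ refl)))
  from : (isSmirnov nothing κ ∧ not (κ fzero =ᶠ κ vertex₂)) ≡ true → properB (lariat n) κ ≡ true
  from h = ⇒properB-true (lariat n) κ edge
    where
    κ₀≢κ₂ : κ fzero ≢ κ vertex₂
    κ₀≢κ₂ κ₀≡κ₂ = true≢false (trans (sym (∧-trueʳ {isSmirnov nothing κ} h))
                               (cong not (trans (cong (_=ᶠ κ vertex₂) κ₀≡κ₂) (=ᶠ-refl _))))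
    edge : ∀ u v → lariat n u v ≡ true → κ u ≢ κ v
    edge u v uv with lariat-edge n u v uv
    ... | inj₁ path-edge           = adjacentDistinct⇒path-edge κ (isSmirnov⇒adjacentDistinct κ (∧-trueˡ h)) u v path-edge
    ... | inj₂ (inj₁ (refl , refl)) = κ₀≢κ₂
    ... | inj₂ (inj₂ (refl , refl)) = κ₀≢κ₂ ∘ sym

module _ {K : ℕ} where

  lariatTail : ℕ → (Fin K → ℕ) → Fin K → Fin K → Fin K → ℕ
  lariatTail M β x y z = when ((not (y =ᶠ z) ∧ not (x =ᶠ z)) ∧ (0 <ᵇ (β ∸[ x ] ∸[ y ]) z))
                              (smirnov M (β ∸[ x ] ∸[ y ] ∸[ z ]) (just z))

  -- Smirnov words x y z w of length M + 3 and content β with x ≠ z, i.e. proper colourings of the lariat.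
  lariatCount : ℕ → (Fin K → ℕ) → ℕ
  lariatCount M β =
    ∑ (allFin K) λ x → when (0 <ᵇ β x) (
    ∑ (allFin K) λ y → when (not (x =ᶠ y) ∧ (0 <ᵇ (β ∸[ x ]) y)) (
    ∑ (allFin K) λ z → lariatTail M β x y z))

  lariatColouring : ∀ {M} → (Fin (3 + M) → Fin K) → (Fin K → ℕ) → Bool
  lariatColouring κ β = (isSmirnov nothing κ ∧ not (κ fzero =ᶠ κ vertex₂)) ∧ hasContent κ β

  lariatColouring-∷ : ∀ {M} x y z (w : Fin M → Fin K) β → lariatColouring (x ∷ᶠ (y ∷ᶠ (z ∷ᶠ w))) β
    ≡ (0 <ᵇ β x) ∧ ((not (x =ᶠ y) ∧ (0 <ᵇ (β ∸[ x ]) y)) ∧ (((not (y =ᶠ z) ∧ not (x =ᶠ z)) ∧ (0 <ᵇ (β ∸[ x ] ∸[ y ]) z))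
                   ∧ (isSmirnov (just z) w ∧ hasContent w (β ∸[ x ] ∸[ y ] ∸[ z ]))))
  lariatColouring-∷ x y z w β = begin
    (isSmirnov nothing (x ∷ᶠ (y ∷ᶠ (z ∷ᶠ w))) ∧ not (x =ᶠ z)) ∧ hasContent (x ∷ᶠ (y ∷ᶠ (z ∷ᶠ w))) β
      ≡⟨ cong (_ ∧_) (trans (hasContent-∷ x _ β) (cong ((0 <ᵇ β x) ∧_)
           (trans (hasContent-∷ y _ _) (cong (_ ∧_) (hasContent-∷ z w _))))) ⟩
    ((true ∧ (not (x =ᶠ y) ∧ (not (y =ᶠ z) ∧ isSmirnov (just z) w))) ∧ not (x =ᶠ z))
      ∧ ((0 <ᵇ β x) ∧ ((0 <ᵇ (β ∸[ x ]) y) ∧ ((0 <ᵇ (β ∸[ x ] ∸[ y ]) z) ∧ hasContent w (β ∸[ x ] ∸[ y ] ∸[ z ]))))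
      ≡⟨ regroup (not (x =ᶠ y)) (not (y =ᶠ z)) (not (x =ᶠ z)) (isSmirnov (just z) w)
                 (0 <ᵇ β x) (0 <ᵇ (β ∸[ x ]) y) (0 <ᵇ (β ∸[ x ] ∸[ y ]) z) (hasContent w (β ∸[ x ] ∸[ y ] ∸[ z ])) ⟩
    _ ∎
    where
    open ≡-Reasoning
    regroup : ∀ a b c s p₁ p₂ p₃ q →
      (((true ∧ (a ∧ (b ∧ s))) ∧ c) ∧ (p₁ ∧ (p₂ ∧ (p₃ ∧ q)))) ≡ (p₁ ∧ ((a ∧ p₂) ∧ (((b ∧ c) ∧ p₃) ∧ (s ∧ q))))
    regroup = solve 8 (λ a b c s p₁ p₂ p₃ q →
      ((con true :* (a :* (b :* s))) :* c) :* (p₁ :* (p₂ :* (p₃ :* q))) := p₁ :* ((a :* p₂) :* (((b :* c) :* p₃) :* (s :* q)))) refl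
      where open ∨-∧-Solver

  ∑-lariat-tails : ∀ M β x y z → ∑ (words M) (λ w → when (lariatColouring (x ∷ᶠ (y ∷ᶠ (z ∷ᶠ w))) β) 1)
    ≡ when (0 <ᵇ β x) (when (not (x =ᶠ y) ∧ (0 <ᵇ (β ∸[ x ]) y)) (lariatTail M β x y z))
  ∑-lariat-tails M β x y z = begin
    ∑ (words M) (λ w → when (lariatColouring (x ∷ᶠ (y ∷ᶠ (z ∷ᶠ w))) β) 1)
      ≡⟨ ∑-cong (words M) (λ w → trans (cong (λ b → when b 1) (lariatColouring-∷ x y z w β))
           (trans (when-∧ first _ 1) (cong (when first) (trans (when-∧ second _ 1) (cong (when second) (when-∧ third _ 1)))))) ⟩
    ∑ (words M) (λ w → when first (when second (when third (when (isSmirnov (just z) w ∧ hasContent w γ) 1))))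
      ≡⟨ trans (∑-when (words M) first _) (cong (when first) (trans (∑-when (words M) second _)
           (cong (when second) (∑-when (words M) third _)))) ⟩
    when first (when second (when third (∑ (words M) (λ w → when (isSmirnov (just z) w ∧ hasContent w γ) 1))))
      ≡⟨ cong (λ t → when first (when second (when third t))) (smirnov-count M (just z) γ) ⟩
    when first (when second (lariatTail M β x y z)) ∎
    where
    open ≡-Reasoning
    first second third : Bool
    first  = 0 <ᵇ β x
    second = not (x =ᶠ y) ∧ (0 <ᵇ (β ∸[ x ]) y)
    third  = (not (y =ᶠ z) ∧ not (x =ᶠ z)) ∧ (0 <ᵇ (β ∸[ x ] ∸[ y ]) z)
    γ : Fin K → ℕ
    γ = β ∸[ x ] ∸[ y ] ∸[ z ]

  lariatCount-words : ∀ M β → ∑ (words (3 + M)) (λ κ → when (lariatColouring κ β) 1) ≡ lariatCount M β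
  lariatCount-words M β = begin
    ∑ (words (3 + M)) F
      ≡⟨ ∑-words-suc (2 + M) F ⟩
    ∑ (allFin K) (λ x → ∑ (words (2 + M)) (λ f → F (x ∷ᶠ f)))
      ≡⟨ ∑-cong (allFin K) (λ x → ∑-words-suc (1 + M) _) ⟩
    ∑ (allFin K) (λ x → ∑ (allFin K) λ y → ∑ (words (1 + M)) (λ f → F (x ∷ᶠ (y ∷ᶠ f))))
      ≡⟨ ∑-cong (allFin K) (λ x → ∑-cong (allFin K) λ y → ∑-words-suc M _) ⟩
    ∑ (allFin K) (λ x → ∑ (allFin K) λ y → ∑ (allFin K) λ z → ∑ (words M) (λ w → F (x ∷ᶠ (y ∷ᶠ (z ∷ᶠ w)))))
      ≡⟨ ∑-cong (allFin K) (λ x → ∑-cong (allFin K) λ y → ∑-cong (allFin K) λ z → ∑-lariat-tails M β x y z) ⟩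
    ∑ (allFin K) (λ x → ∑ (allFin K) λ y → ∑ (allFin K) λ z → when (first x) (when (second x y) (lariatTail M β x y z)))
      ≡⟨ ∑-cong (allFin K) (λ x → ∑-cong (allFin K) λ y →
           trans (∑-when (allFin K) (first x) _) (cong (when (first x)) (∑-when (allFin K) (second x y) _))) ⟩
    ∑ (allFin K) (λ x → ∑ (allFin K) λ y → when (first x) (when (second x y) (∑ (allFin K) (lariatTail M β x y))))
      ≡⟨ ∑-cong (allFin K) (λ x → ∑-when (allFin K) (first x) _) ⟩
    lariatCount M β ∎
    where
    open ≡-Reasoning
    F : (Fin (3 + M) → Fin K) → ℕ
    F κ = when (lariatColouring κ β) 1
    first : Fin K → Bool
    first x = 0 <ᵇ β x
    second : Fin K → Fin K → Bool
    second x y = not (x =ᶠ y) ∧ (0 <ᵇ (β ∸[ x ]) y)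

XCoeff≡∑words : ∀ {N} (G : Graph N) (P : (Fin N → Fin N) → Bool) → (∀ κ → properB G κ ≡ P κ) → ∀ α →
                XCoeff G α ≡ ∑ (words N) (λ κ → when (P κ ∧ hasContent κ α) 1)
XCoeff≡∑words {N} G P proper≡P α = trans (length-filter (words N) _)
  (∑-cong (words N) (λ κ → cong (λ b → when (b ∧ hasContent κ α) 1) (proper≡P κ)))

XCoeff-path : ∀ N α → XCoeff (pathGraph N) α ≡ smirnov N α nothing
XCoeff-path N α = trans (XCoeff≡∑words (pathGraph N) _ (properB-path N) α) (smirnov-count N nothing α)

XCoeff-lariat : ∀ n α → XCoeff (lariat n) α ≡ lariatCount n α
XCoeff-lariat n α = trans (XCoeff≡∑words (lariat n) _ (properB-lariat n) α) (lariatCount-words n α)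

-- Subsets of the variables

indicator-mono : ∀ a b → (a ≡ true → b ≡ true) → when a 1 ≤ when b 1
indicator-mono false b h = z≤n
indicator-mono true  b h rewrite h refl = ≤-refl

module _ {K : ℕ} where

  Extensional : ((Fin K → Bool) → ℕ) → Set
  Extensional g = ∀ {S T} → S ≗ T → g S ≡ g T

  size : (Fin K → Bool) → ℕ
  size = countFin

  ∅ : Fin K → Bool
  ∅ _ = false

  include : Fin K → (Fin K → Bool) → (Fin K → Bool)
  include j S i = (j =ᶠ i) ∨ S i

  infixl 6 _∸ˢ_
  _∸ˢ_ : (Fin K → ℕ) → (Fin K → Bool) → (Fin K → ℕ)
  (α ∸ˢ S) i = α i ∸ b2n (S i)

  supports : (Fin K → ℕ) → (Fin K → Bool) → Bool
  supports α S = andFin (λ i → not (S i) ∨ (0 <ᵇ α i))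

  supports-cong : ∀ α {S T} → S ≗ T → supports α S ≡ supports α T
  supports-cong α S≗T = andFin-cong K (λ i → cong (λ b → not b ∨ (0 <ᵇ α i)) (S≗T i))

  ∸ˢ-cong : ∀ α {S T} → S ≗ T → α ∸ˢ S ≗ α ∸ˢ T
  ∸ˢ-cong α S≗T i = cong (λ b → α i ∸ b2n b) (S≗T i)

  size-∅ : size ∅ ≡ 0
  size-∅ = trans (countFin≡∑ K ∅) (∑-ε (allFin K))

  supports-∅ : ∀ α → supports α ∅ ≡ true
  supports-∅ α = ⇒andFin-true K _ (λ i → refl)

  size-include : ∀ (S : Fin K → Bool) j → S j ≡ false → size (include j S) ≡ suc (size S)
  size-include S j Sj≡false = begin
    size (include j S)                                                      ≡⟨ countFin≡∑ K _ ⟩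
    ∑ (allFin K) (λ i → when ((j =ᶠ i) ∨ S i) 1)                            ≡⟨ ∑-cong (allFin K) split ⟩
    ∑ (allFin K) (λ i → when (S i) 1 + when (j =ᶠ i) 1)                     ≡⟨ ∑-distrib (allFin K) _ _ ⟩
    ∑ (allFin K) (λ i → when (S i) 1) + ∑ (allFin K) (λ i → when (j =ᶠ i) 1)
                                                                            ≡⟨ cong₂ _+_ (sym (countFin≡∑ K S)) (∑-δ K j (λ _ → 1)) ⟩
    size S + 1                                                              ≡⟨ +-comm (size S) 1 ⟩
    suc (size S)                                                            ∎
    where
    open ≡-Reasoning
    split : ∀ i → when ((j =ᶠ i) ∨ S i) 1 ≡ when (S i) 1 + when (j =ᶠ i) 1
    split i with j =ᶠ i in e
    ... | true rewrite sym (=ᶠ-true⇒≡ j i e) | Sj≡false = refl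
    ... | false = sym (+-identityʳ _)

  supports-include : ∀ α (S : Fin K → Bool) j → S j ≡ false → supports α (include j S) ≡ ((0 <ᵇ α j) ∧ supports α S)
  supports-include α S j Sj≡false = ⇔→≡ (mk⇔ to from)
    where
    to : supports α (include j S) ≡ true → ((0 <ᵇ α j) ∧ supports α S) ≡ true
    to h = ∧-true (subst (λ b → (not b ∨ (0 <ᵇ α j)) ≡ true) (cong (_∨ S j) (=ᶠ-refl j)) (andFin-true⇒ K _ h j))
                  (⇒andFin-true K _ λ i → shrink i (andFin-true⇒ K _ h i))
      where
      shrink : ∀ i → (not ((j =ᶠ i) ∨ S i) ∨ (0 <ᵇ α i)) ≡ true → (not (S i) ∨ (0 <ᵇ α i)) ≡ true
      shrink i h′ with S i
      ... | false = refl
      ... | true rewrite ∨-zeroʳ (j =ᶠ i) = h′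
    from : ((0 <ᵇ α j) ∧ supports α S) ≡ true → supports α (include j S) ≡ true
    from h = ⇒andFin-true K _ grow
      where
      grow : ∀ i → (not ((j =ᶠ i) ∨ S i) ∨ (0 <ᵇ α i)) ≡ true
      grow i with j =ᶠ i in e
      ... | true rewrite sym (=ᶠ-true⇒≡ j i e) = ∧-trueˡ {b = supports α S} h
      ... | false = andFin-true⇒ K _ (∧-trueʳ h) i

  ∸ˢ-include : ∀ α (S : Fin K → Bool) j → S j ≡ false → α ∸ˢ include j S ≗ α ∸ˢ S ∸[ j ]
  ∸ˢ-include α S j Sj≡false i with j =ᶠ i in e
  ... | true rewrite sym (=ᶠ-true⇒≡ j i e) | Sj≡false = refl
  ... | false = refl

  size-mono : ∀ (S T : Fin K → Bool) → (∀ i → S i ≡ true → T i ≡ true) → size S ≤ size T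
  size-mono S T S⊆T = subst₂ _≤_ (sym (countFin≡∑ K S)) (sym (countFin≡∑ K T))
    (∑-mono-≤ (allFin K) (λ i → indicator-mono (S i) (T i) (S⊆T i)))

∷ᶠ-cong : ∀ {K} {S T : Fin K → Bool} b → S ≗ T → (b ∷ᶠ S) ≗ (b ∷ᶠ T)
∷ᶠ-cong b S≗T fzero    = refl
∷ᶠ-cong b S≗T (fsuc i) = S≗T i

⊆⇒⊇ : ∀ K (S T : Fin K → Bool) → (∀ i → S i ≡ true → T i ≡ true) → size T ≤ size S → ∀ i → T i ≡ true → S i ≡ true
⊆⇒⊇ (suc K) S T S⊆T T≤S i Ti with squeeze (size-mono (S ∘ fsuc) (T ∘ fsuc) (S⊆T ∘ fsuc))
                                      (subst₂ _≤_ (countFin-suc K T) (countFin-suc K S) T≤S)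
  where
  squeeze : ∀ {c d} → c ≤ d → when (T fzero) 1 + d ≤ when (S fzero) 1 + c → when (T fzero) 1 ≤ when (S fzero) 1 × d ≤ c
  squeeze {c} {d} c≤d le = +-cancelʳ-≤ d _ _ (≤-trans le (+-monoʳ-≤ _ c≤d))
                         , +-cancelˡ-≤ _ d c (≤-trans le (+-monoˡ-≤ c (indicator-mono (S fzero) (T fzero) (S⊆T fzero))))
⊆⇒⊇ (suc K) S T S⊆T T≤S fzero Ti | T₀≤S₀ , _ = head (S fzero) (T fzero) T₀≤S₀ Ti
  where
  head : ∀ a b → when b 1 ≤ when a 1 → b ≡ true → a ≡ true
  head true  b    _  _ = refl
  head false true () _
⊆⇒⊇ (suc K) S T S⊆T T≤S (fsuc i) Ti | _ , rest = ⊆⇒⊇ K (S ∘ fsuc) (T ∘ fsuc) (S⊆T ∘ fsuc) rest i Ti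

∑-subsets-suc : ∀ K (g : (Fin (suc K) → Bool) → ℕ) →
                ∑ (subsets (suc K)) g ≡ ∑ (subsets K) (λ S → g (true ∷ᶠ S) + g (false ∷ᶠ S))
∑-subsets-suc K g = trans (∑-concatMap (subsets K) _ g)
  (∑-cong (subsets K) λ S → cong (_+_ (g (true ∷ᶠ S))) (+-identityʳ _))

∑-subsets-toggle : ∀ K (j : Fin K) (g : (Fin K → Bool) → ℕ) → Extensional g →
                   ∑ (subsets K) g ≡ ∑ (subsets K) (λ S → when (not (S j)) (g S + g (include j S)))
∑-subsets-toggle (suc K) fzero g g-ext = trans (∑-subsets-suc K g) (trans (∑-cong (subsets K) λ S →
    trans (+-comm (g (true ∷ᶠ S)) _) (cong (_+_ (g (false ∷ᶠ S))) (g-ext (include-zero S))))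
  (sym (∑-subsets-suc K _)))
  where
  include-zero : ∀ S → (true ∷ᶠ S) ≗ include fzero (false ∷ᶠ S)
  include-zero S fzero    = refl
  include-zero S (fsuc i) = refl
∑-subsets-toggle (suc K) (fsuc j) g g-ext = begin
  ∑ (subsets (suc K)) g
    ≡⟨ trans (∑-subsets-suc K g) (∑-distrib (subsets K) _ _) ⟩
  ∑ (subsets K) (g ∘ (true ∷ᶠ_)) + ∑ (subsets K) (g ∘ (false ∷ᶠ_))
    ≡⟨ cong₂ _+_ (trans (∑-subsets-toggle K j (g ∘ (true ∷ᶠ_)) (g-ext ∘ ∷ᶠ-cong true)) (∑-cong (subsets K) (toggled-∷ true)))
                 (trans (∑-subsets-toggle K j (g ∘ (false ∷ᶠ_)) (g-ext ∘ ∷ᶠ-cong false)) (∑-cong (subsets K) (toggled-∷ false))) ⟩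
  ∑ (subsets K) (λ S → toggled (true ∷ᶠ S)) + ∑ (subsets K) (λ S → toggled (false ∷ᶠ S))
    ≡⟨ trans (sym (∑-distrib (subsets K) _ _)) (sym (∑-subsets-suc K toggled)) ⟩
  ∑ (subsets (suc K)) toggled ∎
  where
  open ≡-Reasoning
  toggled : (Fin (suc K) → Bool) → ℕ
  toggled S = when (not (S (fsuc j))) (g S + g (include (fsuc j) S))
  include-suc : ∀ b S → (b ∷ᶠ include j S) ≗ include (fsuc j) (b ∷ᶠ S)
  include-suc b S fzero    = refl
  include-suc b S (fsuc i) = cong (_∨ S i) (sym (=ᶠ-suc j i))
  toggled-∷ : ∀ b S → when (not (S j)) (g (b ∷ᶠ S) + g (b ∷ᶠ include j S)) ≡ toggled (b ∷ᶠ S)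
  toggled-∷ b S = cong (λ t → when (not (S j)) (g (b ∷ᶠ S) + t)) (g-ext (include-suc b S))

-- Double counting of the pairs (S, j) with j ∈ S.
∑-size-* : ∀ K (f : (Fin K → Bool) → ℕ) → Extensional f →
           ∑ (subsets K) (λ S → size S * f S) ≡ ∑ (allFin K) (λ j → ∑ (subsets K) (λ S → when (not (S j)) (f (include j S))))
∑-size-* K f f-ext = begin
  ∑ (subsets K) (λ S → size S * f S)
    ≡⟨ ∑-cong (subsets K) (λ S → ∑-indicator K S (f S)) ⟨
  ∑ (subsets K) (λ S → ∑ (allFin K) (λ j → when (S j) (f S)))
    ≡⟨ ∑-comm (subsets K) (allFin K) _ ⟩
  ∑ (allFin K) (λ j → ∑ (subsets K) (λ S → when (S j) (f S)))
    ≡⟨ ∑-cong (allFin K) (λ j → trans (∑-subsets-toggle K j (λ S → when (S j) (f S)) (λ S≗T → cong₂ when (S≗T j) (f-ext S≗T)))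
                                      (∑-cong (subsets K) (only-include j))) ⟩
  ∑ (allFin K) (λ j → ∑ (subsets K) (λ S → when (not (S j)) (f (include j S)))) ∎
  where
  open ≡-Reasoning
  only-include : ∀ j S → when (not (S j)) (when (S j) (f S) + when (include j S j) (f (include j S))) ≡ when (not (S j)) (f (include j S))
  only-include j S with S j
  ... | true  = refl
  ... | false rewrite =ᶠ-refl j = refl

false∷∅ : ∀ {K} → (false ∷ᶠ ∅) ≗ ∅ {suc K}
false∷∅ fzero    = refl
false∷∅ (fsuc i) = refl

∑-subsets-∅ : ∀ K (g : (Fin K → Bool) → ℕ) → Extensional g → ∑ (subsets K) (λ S → when (size S ≡ᵇ 0) (g S)) ≡ g ∅
∑-subsets-∅ zero    g g-ext = trans (+-identityʳ _) (g-ext (λ ()))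
∑-subsets-∅ (suc K) g g-ext = begin
  ∑ (subsets (suc K)) (λ S → when (size S ≡ᵇ 0) (g S))
    ≡⟨ ∑-subsets-suc K _ ⟩
  ∑ (subsets K) (λ S → when (size (true ∷ᶠ S) ≡ᵇ 0) (g (true ∷ᶠ S)) + when (size (false ∷ᶠ S) ≡ᵇ 0) (g (false ∷ᶠ S)))
    ≡⟨ ∑-cong (subsets K) (λ S → cong₂ _+_ (cong (λ m → when (m ≡ᵇ 0) (g (true ∷ᶠ S))) (countFin-suc K (true ∷ᶠ S)))
                                             (cong (λ m → when (m ≡ᵇ 0) (g (false ∷ᶠ S))) (countFin-suc K (false ∷ᶠ S)))) ⟩
  ∑ (subsets K) (λ S → when (size S ≡ᵇ 0) (g (false ∷ᶠ S)))
    ≡⟨ ∑-subsets-∅ K (g ∘ (false ∷ᶠ_)) (g-ext ∘ ∷ᶠ-cong false) ⟩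
  g (false ∷ᶠ ∅)
    ≡⟨ g-ext false∷∅ ⟩
  g ∅ ∎
  where open ≡-Reasoning

_⇔ᵇ_ : Bool → Bool → Bool
true  ⇔ᵇ b = b
false ⇔ᵇ b = not b

⇔ᵇ-true⇒≡ : ∀ a b → (a ⇔ᵇ b) ≡ true → a ≡ b
⇔ᵇ-true⇒≡ true  true  _ = refl
⇔ᵇ-true⇒≡ false false _ = refl

sameSubset : ∀ {K} → (Fin K → Bool) → (Fin K → Bool) → Bool
sameSubset S T = andFin (λ i → S i ⇔ᵇ T i)

∑-subsets-single : ∀ K (T : Fin K → Bool) (g : (Fin K → Bool) → ℕ) → Extensional g →
                   ∑ (subsets K) (λ S → when (sameSubset S T) (g S)) ≡ g T
∑-subsets-single zero    T g g-ext = trans (+-identityʳ _) (g-ext (λ ()))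
∑-subsets-single (suc K) T g g-ext = begin
  ∑ (subsets (suc K)) (λ S → when (sameSubset S T) (g S))
    ≡⟨ ∑-subsets-suc K _ ⟩
  ∑ (subsets K) (λ S → when (sameSubset (true ∷ᶠ S) T) (g (true ∷ᶠ S)) + when (sameSubset (false ∷ᶠ S) T) (g (false ∷ᶠ S)))
    ≡⟨ ∑-cong (subsets K) (λ S → cong₂ _+_ (cong (λ b → when b (g (true ∷ᶠ S))) (andFin-suc K (λ i → (true ∷ᶠ S) i ⇔ᵇ T i)))
                                             (cong (λ b → when b (g (false ∷ᶠ S))) (andFin-suc K (λ i → (false ∷ᶠ S) i ⇔ᵇ T i)))) ⟩
  ∑ (subsets K) (λ S → when ((true ⇔ᵇ T fzero) ∧ sameSubset S (T ∘ fsuc)) (g (true ∷ᶠ S))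
                     + when ((false ⇔ᵇ T fzero) ∧ sameSubset S (T ∘ fsuc)) (g (false ∷ᶠ S)))
    ≡⟨ by-head (T fzero) refl ⟩
  g T ∎
  where
  open ≡-Reasoning
  by-head : ∀ b → T fzero ≡ b →
            ∑ (subsets K) (λ S → when ((true ⇔ᵇ b) ∧ sameSubset S (T ∘ fsuc)) (g (true ∷ᶠ S))
                               + when ((false ⇔ᵇ b) ∧ sameSubset S (T ∘ fsuc)) (g (false ∷ᶠ S))) ≡ g T
  by-head b T₀≡b = trans (∑-cong (subsets K) (λ S → head-term {S} b))
    (trans (∑-subsets-single K (T ∘ fsuc) (g ∘ (b ∷ᶠ_)) (g-ext ∘ ∷ᶠ-cong b)) (g-ext restore))
    where
    head-term : ∀ {S} b → when ((true ⇔ᵇ b) ∧ sameSubset S (T ∘ fsuc)) (g (true ∷ᶠ S))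
                          + when ((false ⇔ᵇ b) ∧ sameSubset S (T ∘ fsuc)) (g (false ∷ᶠ S))
                          ≡ when (sameSubset S (T ∘ fsuc)) (g (b ∷ᶠ S))
    head-term true  = +-identityʳ _
    head-term false = refl
    restore : (b ∷ᶠ (T ∘ fsuc)) ≗ T
    restore fzero    = sym T₀≡b
    restore (fsuc i) = refl

below : ∀ {K} → ℕ → Fin K → Bool
below p j = toℕ j <ᵇ p

size-below : ∀ K p → p ≤ K → size {K} (below p) ≡ p
size-below K p p≤K = trans (countFin≡∑ K (below p)) (count K p p≤K)
  where
  count : ∀ K p → p ≤ K → ∑ (allFin K) (λ j → when (toℕ j <ᵇ p) 1) ≡ p
  count zero    zero    z≤n       = refl
  count (suc K) zero    z≤n       = trans (∑-allFin-suc K (λ j → when (toℕ j <ᵇ 0) 1)) (∑-ε (allFin K))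
  count (suc K) (suc p) (s≤s p≤K) = trans (∑-allFin-suc K (λ j → when (toℕ j <ᵇ suc p) 1)) (cong suc (count K p p≤K))

-- The recursion for X_{P_M}

eCoeff-∷ : ∀ {K} k μ (α : Fin K → ℕ) →
           eCoeff (k ∷ μ) α ≡ ∑ (subsets K) (λ S → when ((size S ≡ᵇ k) ∧ supports α S) (eCoeff μ (α ∸ˢ S)))
eCoeff-∷ {K} k μ α = ∑-filter (subsets K) (λ S → (size S ≡ᵇ k) ∧ supports α S) (λ S → eCoeff μ (α ∸ˢ S))

downFrom⁺ : ℕ → List ℕ
downFrom⁺ = applyDownFrom suc

∑-downFrom⁺-δ : ∀ M s (F : ℕ → ℕ) → ∑ (downFrom⁺ M) (λ i → when (s ≡ᵇ i) (F i)) ≡ when ((0 <ᵇ s) ∧ (s <ᵇ suc M)) (F s)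
∑-downFrom⁺-δ zero    zero    F = refl
∑-downFrom⁺-δ zero    (suc s) F = refl
∑-downFrom⁺-δ (suc M) s       F with s ≡ᵇ suc M in e
... | true rewrite ≡ᵇ-true⇒≡ s (suc M) e
                 | ∑-downFrom⁺-δ M (suc M) F
                 | ≤⇒>ᵇ-false (suc M) (suc M) ≤-refl
                 | <⇒<ᵇ-true (suc M) (suc (suc M)) ≤-refl = +-identityʳ _
... | false = trans (∑-downFrom⁺-δ M s F) (cong (λ b → when ((0 <ᵇ s) ∧ b) (F s)) (<ᵇ-suc s M e))
  where
  <ᵇ-suc : ∀ s M → (s ≡ᵇ suc M) ≡ false → (s <ᵇ suc M) ≡ (s <ᵇ suc (suc M))
  <ᵇ-suc zero          M       _ = refl
  <ᵇ-suc (suc zero)    zero    ()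
  <ᵇ-suc (suc (suc s)) zero    _ = refl
  <ᵇ-suc (suc s)       (suc M) e = <ᵇ-suc s M e

module _ {K : ℕ} where

  smirnovEmpty : ℕ → (Fin K → ℕ) → ℕ
  smirnovEmpty zero    γ = when (isZero γ) 1
  smirnovEmpty (suc m) γ = 0

  smirnovFrom : ℕ → (Fin K → ℕ) → Fin K → ℕ
  smirnovFrom zero    γ j = 0
  smirnovFrom (suc m) γ j = when (0 <ᵇ γ j) (smirnov m (γ ∸[ j ]) (just j))

  smirnovFrom-cong : ∀ m {γ δ} j → γ ≗ δ → smirnovFrom m γ j ≡ smirnovFrom m δ j
  smirnovFrom-cong zero    j γ≗δ = refl
  smirnovFrom-cong (suc m) j γ≗δ = cong₂ when (cong (0 <ᵇ_) (γ≗δ j)) (smirnov-cong m (just j) (∸[]-cong j γ≗δ))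

  smirnov-by-first-letter : ∀ m γ → smirnov m γ nothing ≡ smirnovEmpty m γ + ∑ (allFin K) (smirnovFrom m γ)
  smirnov-by-first-letter zero    γ = sym (trans (cong (_+_ (when (isZero γ) 1)) (∑-ε (allFin K))) (+-identityʳ _))
  smirnov-by-first-letter (suc m) γ = refl

  smirnov-nothing : ∀ m γ j → smirnov m γ nothing ≡ smirnov m γ (just j) + smirnovFrom m γ j
  smirnov-nothing zero    γ j = sym (+-identityʳ _)
  smirnov-nothing (suc m) γ j = trans (∑-cong (allFin K) split)
    (trans (∑-distrib (allFin K) _ _) (cong (_+_ (smirnov (suc m) γ (just j))) (∑-δ K j _)))
    where
    split : ∀ x → when (0 <ᵇ γ x) (smirnov m (γ ∸[ x ]) (just x))
                  ≡ when (not (j =ᶠ x) ∧ (0 <ᵇ γ x)) (smirnov m (γ ∸[ x ]) (just x))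
                    + when (j =ᶠ x) (when (0 <ᵇ γ x) (smirnov m (γ ∸[ x ]) (just x)))
    split x with j =ᶠ x
    ... | true  = refl
    ... | false = sym (+-identityʳ _)

  -- The two identities below are about a subset S with s = |S| ≤ M, γ = β − S and sup = (S ⊆ supp β).
  smirnovEmpty-after : ∀ M s γ sup →
    when (sup ∧ (s <ᵇ suc M)) (smirnovEmpty (M ∸ s) γ) ≡ when ((s ≡ᵇ M) ∧ sup) (when (isZero γ) 1)
  smirnovEmpty-after zero    zero    γ sup rewrite ∧-identityʳ sup = refl
  smirnovEmpty-after zero    (suc s) γ sup rewrite ∧-zeroʳ sup = refl
  smirnovEmpty-after (suc M) zero    γ sup = when-ε (sup ∧ true)
  smirnovEmpty-after (suc M) (suc s) γ sup = smirnovEmpty-after M s γ sup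

  -- A word of content γ - j either starts with j or, prefixed by j, is a word of content γ starting with j.
  smirnovFrom-include : ∀ M s γ j sup →
    when (sup ∧ (s <ᵇ suc M)) (smirnovFrom (M ∸ s) γ j)
      + when (((0 <ᵇ γ j) ∧ sup) ∧ (s <ᵇ M)) (smirnovFrom (M ∸ suc s) (γ ∸[ j ]) j)
    ≡ when (((0 <ᵇ γ j) ∧ sup) ∧ (s <ᵇ M)) (smirnov (M ∸ suc s) (γ ∸[ j ]) nothing)
  smirnovFrom-include zero    zero    γ j sup rewrite ∧-zeroʳ ((0 <ᵇ γ j) ∧ sup) = trans (+-identityʳ _) (when-ε _)
  smirnovFrom-include zero    (suc s) γ j sup rewrite ∧-zeroʳ sup | ∧-zeroʳ ((0 <ᵇ γ j) ∧ sup) = refl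
  smirnovFrom-include (suc M) zero    γ j sup
    rewrite ∧-identityʳ sup | ∧-identityʳ ((0 <ᵇ γ j) ∧ sup) | smirnov-nothing M (γ ∸[ j ]) j = shuffle (0 <ᵇ γ j) sup
    where
    shuffle : ∀ p sup {a b} → when sup (when p a) + when (p ∧ sup) b ≡ when (p ∧ sup) (a + b)
    shuffle true  true  = refl
    shuffle true  false = refl
    shuffle false true  = refl
    shuffle false false = refl
  smirnovFrom-include (suc M) (suc s) γ j sup = smirnovFrom-include M s γ j sup

module _ {K : ℕ} (M : ℕ) (β : Fin K → ℕ) where

  afterRemoving : (ℕ → (Fin K → ℕ) → ℕ) → (Fin K → Bool) → ℕ
  afterRemoving F S = when (supports β S ∧ (size S <ᵇ suc M)) (F (M ∸ size S) (β ∸ˢ S))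

  module _ (F : ℕ → (Fin K → ℕ) → ℕ) (F-cong : ∀ m {γ δ} → γ ≗ δ → F m γ ≡ F m δ) where

    afterRemoving-ext : Extensional (afterRemoving F)
    afterRemoving-ext {S} {T} S≗T rewrite supports-cong β S≗T | countFin-cong K S≗T =
      cong (when _) (F-cong _ (∸ˢ-cong β S≗T))

    afterRemoving-include : ∀ S j → S j ≡ false → afterRemoving F (include j S)
      ≡ when (((0 <ᵇ (β ∸ˢ S) j) ∧ supports β S) ∧ (size S <ᵇ M)) (F (M ∸ suc (size S)) (β ∸ˢ S ∸[ j ]))
    afterRemoving-include S j Sj≡false rewrite size-include S j Sj≡false | supports-include β S j Sj≡false =
      cong₂ (λ b → when ((b ∧ supports β S) ∧ (size S <ᵇ M)))
            (cong (λ b → 0 <ᵇ β j ∸ b2n b) (sym Sj≡false)) (F-cong _ (∸ˢ-include β S j Sj≡false))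

  remaining : (Fin K → Bool) → ℕ
  remaining = afterRemoving (λ m γ → smirnov m γ nothing)

  remainingFrom : Fin K → (Fin K → Bool) → ℕ
  remainingFrom j = afterRemoving (λ m γ → smirnovFrom m γ j)

  remaining-ext : Extensional remaining
  remaining-ext = afterRemoving-ext _ (λ m → smirnov-cong m nothing)

  remainingFrom-ext : ∀ j → Extensional (remainingFrom j)
  remainingFrom-ext j = afterRemoving-ext _ (λ m → smirnovFrom-cong m j)

  remainingFrom-include : ∀ S j → S j ≡ false → remainingFrom j S + remainingFrom j (include j S) ≡ remaining (include j S)
  remainingFrom-include S j Sj≡false = begin
    remainingFrom j S + remainingFrom j (include j S)
      ≡⟨ cong (_+_ (remainingFrom j S)) (afterRemoving-include _ (λ m → smirnovFrom-cong m j) S j Sj≡false) ⟩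
    _ ≡⟨ smirnovFrom-include M (size S) (β ∸ˢ S) j (supports β S) ⟩
    _ ≡⟨ sym (afterRemoving-include _ (λ m → smirnov-cong m nothing) S j Sj≡false) ⟩
    remaining (include j S) ∎
    where open ≡-Reasoning

  ∑-remainingFrom : ∀ j → ∑ (subsets K) (remainingFrom j) ≡ ∑ (subsets K) (λ S → when (not (S j)) (remaining (include j S)))
  ∑-remainingFrom j = trans (∑-subsets-toggle K j (remainingFrom j) (remainingFrom-ext j)) (∑-cong (subsets K) toggled)
    where
    toggled : ∀ S → when (not (S j)) (remainingFrom j S + remainingFrom j (include j S)) ≡ when (not (S j)) (remaining (include j S))
    toggled S with S j in Sj
    ... | true  = refl
    ... | false = remainingFrom-include S j Sj

  -- Sort the pairs (S, w) by the first letter of the Smirnov word w.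
  ∑-remaining : ∑ (subsets K) remaining ≡ eCoeff (M ∷ []) β + ∑ (subsets K) (λ S → size S * remaining S)
  ∑-remaining = begin
    ∑ (subsets K) remaining
      ≡⟨ ∑-cong (subsets K) by-first-letter ⟩
    ∑ (subsets K) (λ S → when (guard S) (smirnovEmpty (M ∸ size S) (β ∸ˢ S)) + ∑ (allFin K) (λ j → remainingFrom j S))
      ≡⟨ ∑-distrib (subsets K) _ _ ⟩
    ∑ (subsets K) (λ S → when (guard S) (smirnovEmpty (M ∸ size S) (β ∸ˢ S))) + ∑ (subsets K) (λ S → ∑ (allFin K) (λ j → remainingFrom j S))
      ≡⟨ cong₂ _+_ (trans (∑-cong (subsets K) (λ S → smirnovEmpty-after M (size S) (β ∸ˢ S) (supports β S))) (sym (eCoeff-∷ M [] β)))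
                   (∑-comm (subsets K) (allFin K) (λ S j → remainingFrom j S)) ⟩
    eCoeff (M ∷ []) β + ∑ (allFin K) (λ j → ∑ (subsets K) (remainingFrom j))
      ≡⟨ cong (_+_ (eCoeff (M ∷ []) β)) (∑-cong (allFin K) ∑-remainingFrom) ⟩
    eCoeff (M ∷ []) β + ∑ (allFin K) (λ j → ∑ (subsets K) (λ S → when (not (S j)) (remaining (include j S))))
      ≡⟨ cong (_+_ (eCoeff (M ∷ []) β)) (∑-size-* K remaining remaining-ext) ⟨
    eCoeff (M ∷ []) β + ∑ (subsets K) (λ S → size S * remaining S) ∎
    where
    open ≡-Reasoning
    guard : (Fin K → Bool) → Bool
    guard S = supports β S ∧ (size S <ᵇ suc M)
    by-first-letter : ∀ S → remaining S ≡ when (guard S) (smirnovEmpty (M ∸ size S) (β ∸ˢ S)) + ∑ (allFin K) (λ j → remainingFrom j S)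
    by-first-letter S = trans (cong (when (guard S)) (smirnov-by-first-letter (M ∸ size S) (β ∸ˢ S)))
      (trans (when-distrib (guard S) _ _) (cong (_+_ _) (sym (∑-when (allFin K) (guard S) _))))

  ∑-remaining-by-size : ∑ (subsets K) (λ S → when (0 <ᵇ size S) ((size S ∸ 1) * remaining S))
    ≡ ∑ (downFrom⁺ M) (λ i → (i ∸ 1) * ∑ (subsets K) (λ S → when ((size S ≡ᵇ i) ∧ supports β S) (smirnov (M ∸ i) (β ∸ˢ S) nothing)))
  ∑-remaining-by-size = sym (trans (∑-cong (downFrom⁺ M) (λ i → sym (*-distribˡ-∑ (subsets K) (i ∸ 1) _)))
    (trans (∑-comm (downFrom⁺ M) (subsets K) _) (∑-cong (subsets K) (λ S →
      trans (∑-cong (downFrom⁺ M) (λ i → pull-size i S))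
        (trans (∑-downFrom⁺-δ M (size S) _) (push-guards (0 <ᵇ size S) (size S <ᵇ suc M) (supports β S) (size S ∸ 1) _))))))
    where
    pull-size : ∀ i S → (i ∸ 1) * when ((size S ≡ᵇ i) ∧ supports β S) (smirnov (M ∸ i) (β ∸ˢ S) nothing)
                        ≡ when (size S ≡ᵇ i) ((i ∸ 1) * when (supports β S) (smirnov (M ∸ i) (β ∸ˢ S) nothing))
    pull-size i S with size S ≡ᵇ i
    ... | true  = refl
    ... | false = *-zeroʳ (i ∸ 1)
    push-guards : ∀ a b c (n y : ℕ) → when (a ∧ b) (n * when c y) ≡ when a (n * when (c ∧ b) y)
    push-guards false b     c     n y = refl
    push-guards true  true  c     n y = cong (λ c′ → n * when c′ y) (sym (∧-identityʳ c))
    push-guards true  false c     n y = trans (sym (*-zeroʳ n)) (cong (λ c′ → n * when c′ y) (sym (∧-zeroʳ c)))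

  smirnov-recursion : smirnov M β nothing ≡ eCoeff (M ∷ []) β
    + ∑ (downFrom⁺ M) (λ i → (i ∸ 1) * ∑ (subsets K) (λ S → when ((size S ≡ᵇ i) ∧ supports β S) (smirnov (M ∸ i) (β ∸ˢ S) nothing)))
  smirnov-recursion = begin
    smirnov M β nothing          ≡⟨ +-cancelʳ-≡ _ _ _ (begin
      smirnov M β nothing + A      ≡⟨ cong (_+ A) remaining-∅ ⟨
      remaining ∅ + A              ≡⟨ split-by-size ⟨
      ∑ (subsets K) remaining      ≡⟨ ∑-remaining ⟩
      eCoeff (M ∷ []) β + ∑ (subsets K) (λ S → size S * remaining S)
                                   ≡⟨ cong (_+_ (eCoeff (M ∷ []) β)) (trans split-multiplicity (+-comm A B)) ⟩
      eCoeff (M ∷ []) β + (B + A)  ≡⟨ +-assoc (eCoeff (M ∷ []) β) B A ⟨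
      eCoeff (M ∷ []) β + B + A    ∎) ⟩
    eCoeff (M ∷ []) β + B        ≡⟨ cong (_+_ (eCoeff (M ∷ []) β)) ∑-remaining-by-size ⟩
    _                            ∎
    where
    open ≡-Reasoning
    A B : ℕ
    A = ∑ (subsets K) (λ S → when (0 <ᵇ size S) (remaining S))
    B = ∑ (subsets K) (λ S → when (0 <ᵇ size S) ((size S ∸ 1) * remaining S))
    remaining-∅ : remaining ∅ ≡ smirnov M β nothing
    remaining-∅ = cong₂ (λ b n → when (b ∧ (n <ᵇ suc M)) (smirnov (M ∸ n) β nothing)) (supports-∅ β) (size-∅ {K})
    split-by-size : ∑ (subsets K) remaining ≡ remaining ∅ + A
    split-by-size = trans (∑-cong (subsets K) (λ S → split (remaining S) (size S)))
      (trans (∑-distrib (subsets K) _ _) (cong (_+ A) (∑-subsets-∅ K remaining remaining-ext)))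
      where
      split : ∀ x n → x ≡ when (n ≡ᵇ 0) x + when (0 <ᵇ n) x
      split x zero    = sym (+-identityʳ x)
      split x (suc n) = refl
    split-multiplicity : ∑ (subsets K) (λ S → size S * remaining S) ≡ A + B
    split-multiplicity = trans (∑-cong (subsets K) (λ S → split (size S) (remaining S))) (∑-distrib (subsets K) _ _)
      where
      split : ∀ n x → n * x ≡ when (0 <ᵇ n) x + when (0 <ᵇ n) ((n ∸ 1) * x)
      split zero    x = refl
      split (suc n) x = refl

-- Elementary symmetric functions and their linear combinations

eCoeff-cong : ∀ {K} μ {α α′ : Fin K → ℕ} → α ≗ α′ → eCoeff μ α ≡ eCoeff μ α′
eCoeff-cong {K} []      α≗α′ = cong (λ b → when b 1) (andFin-cong K (λ i → cong (_≡ᵇ 0) (α≗α′ i)))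
eCoeff-cong {K} (k ∷ μ) {α} {α′} α≗α′ = trans (eCoeff-∷ k μ α) (trans (∑-cong (subsets K) (λ S →
    cong₂ (λ b → when ((size S ≡ᵇ k) ∧ b)) (andFin-cong K (λ i → cong (λ a → not (S i) ∨ (0 <ᵇ a)) (α≗α′ i)))
          (eCoeff-cong μ (λ i → cong (_∸ b2n (S i)) (α≗α′ i)))))
  (sym (eCoeff-∷ k μ α′)))

module _ {K : ℕ} where

  ∸ˢ-comm : ∀ (α : Fin K → ℕ) S T → α ∸ˢ S ∸ˢ T ≗ α ∸ˢ T ∸ˢ S
  ∸ˢ-comm α S T i = trans (∸-+-assoc (α i) (b2n (S i)) (b2n (T i)))
    (trans (cong (α i ∸_) (+-comm (b2n (S i)) (b2n (T i)))) (sym (∸-+-assoc (α i) (b2n (T i)) (b2n (S i)))))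

  supports-∸ˢ-comm : ∀ (α : Fin K → ℕ) S T → (supports α S ∧ supports (α ∸ˢ S) T) ≡ (supports α T ∧ supports (α ∸ˢ T) S)
  supports-∸ˢ-comm α S T = trans (andFin-∧ K _ _) (trans (andFin-cong K (λ i → pointwise (S i) (T i) (α i))) (sym (andFin-∧ K _ _)))
    where
    pointwise : ∀ s t a → ((not s ∨ (0 <ᵇ a)) ∧ (not t ∨ (0 <ᵇ a ∸ b2n s))) ≡ ((not t ∨ (0 <ᵇ a)) ∧ (not s ∨ (0 <ᵇ a ∸ b2n t)))
    pointwise false false a             = refl
    pointwise false true  zero          = refl
    pointwise false true  (suc a)       = refl
    pointwise true  false zero          = refl
    pointwise true  false (suc a)       = refl
    pointwise true  true  zero          = refl
    pointwise true  true  (suc zero)    = refl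
    pointwise true  true  (suc (suc a)) = refl

  eCoeff-swap : ∀ a b μ (α : Fin K → ℕ) → eCoeff (a ∷ b ∷ μ) α ≡ eCoeff (b ∷ a ∷ μ) α
  eCoeff-swap a b μ α = begin
    eCoeff (a ∷ b ∷ μ) α
      ≡⟨ trans (eCoeff-∷ a (b ∷ μ) α) (∑-cong (subsets K) (λ S → cong (when _) (eCoeff-∷ b μ (α ∸ˢ S)))) ⟩
    ∑ (subsets K) (λ S → when ((size S ≡ᵇ a) ∧ supports α S) (∑ (subsets K) (λ T → term S T)))
      ≡⟨ ∑-cong (subsets K) (λ S → sym (∑-when (subsets K) _ _)) ⟩
    ∑ (subsets K) (λ S → ∑ (subsets K) (λ T → when ((size S ≡ᵇ a) ∧ supports α S) (term S T)))
      ≡⟨ ∑-cong (subsets K) (λ S → ∑-cong (subsets K) (λ T → symmetric S T)) ⟩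
    ∑ (subsets K) (λ S → ∑ (subsets K) (λ T → when ((size T ≡ᵇ b) ∧ supports α T) (term′ T S)))
      ≡⟨ ∑-comm (subsets K) (subsets K) _ ⟩
    ∑ (subsets K) (λ T → ∑ (subsets K) (λ S → when ((size T ≡ᵇ b) ∧ supports α T) (term′ T S)))
      ≡⟨ ∑-cong (subsets K) (λ T → ∑-when (subsets K) _ _) ⟩
    ∑ (subsets K) (λ T → when ((size T ≡ᵇ b) ∧ supports α T) (∑ (subsets K) (λ S → term′ T S)))
      ≡⟨ sym (trans (eCoeff-∷ b (a ∷ μ) α) (∑-cong (subsets K) (λ T → cong (when _) (eCoeff-∷ a μ (α ∸ˢ T))))) ⟩
    eCoeff (b ∷ a ∷ μ) α ∎
    where
    open ≡-Reasoning
    term : (Fin K → Bool) → (Fin K → Bool) → ℕ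
    term S T = when ((size T ≡ᵇ b) ∧ supports (α ∸ˢ S) T) (eCoeff μ (α ∸ˢ S ∸ˢ T))
    term′ : (Fin K → Bool) → (Fin K → Bool) → ℕ
    term′ T S = when ((size S ≡ᵇ a) ∧ supports (α ∸ˢ T) S) (eCoeff μ (α ∸ˢ T ∸ˢ S))
    regroup : ∀ p q (x y : Bool) (E : ℕ) → when (p ∧ x) (when (q ∧ y) E) ≡ when p (when q (when (x ∧ y) E))
    regroup true  true  true  true  E = refl
    regroup true  true  true  false E = refl
    regroup true  true  false y     E = refl
    regroup true  false x     y     E = when-ε x
    regroup false q     x     y     E = refl
    symmetric : ∀ S T → when ((size S ≡ᵇ a) ∧ supports α S) (term S T) ≡ when ((size T ≡ᵇ b) ∧ supports α T) (term′ T S)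
    symmetric S T = begin
      when ((size S ≡ᵇ a) ∧ supports α S) (term S T)
        ≡⟨ regroup (size S ≡ᵇ a) (size T ≡ᵇ b) (supports α S) _ _ ⟩
      when (size S ≡ᵇ a) (when (size T ≡ᵇ b) (when (supports α S ∧ supports (α ∸ˢ S) T) (eCoeff μ (α ∸ˢ S ∸ˢ T))))
        ≡⟨ cong₂ (λ c x → when (size S ≡ᵇ a) (when (size T ≡ᵇ b) (when c x)))
                 (supports-∸ˢ-comm α S T) (eCoeff-cong μ (∸ˢ-comm α S T)) ⟩
      when (size S ≡ᵇ a) (when (size T ≡ᵇ b) (when (supports α T ∧ supports (α ∸ˢ T) S) (eCoeff μ (α ∸ˢ T ∸ˢ S))))
        ≡⟨ when-comm (size S ≡ᵇ a) (size T ≡ᵇ b) _ ⟩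
      when (size T ≡ᵇ b) (when (size S ≡ᵇ a) (when (supports α T ∧ supports (α ∸ˢ T) S) (eCoeff μ (α ∸ˢ T ∸ˢ S))))
        ≡⟨ regroup (size T ≡ᵇ b) (size S ≡ᵇ a) (supports α T) _ _ ⟨
      when ((size T ≡ᵇ b) ∧ supports α T) (term′ T S) ∎

insertPart : ℕ → List ℕ → List ℕ
insertPart i []      = i ∷ []
insertPart i (m ∷ μ) = if m ≤ᵇ i then i ∷ m ∷ μ else m ∷ insertPart i μ

eCoeff-insertPart : ∀ {K} i μ (α : Fin K → ℕ) → eCoeff (insertPart i μ) α ≡ eCoeff (i ∷ μ) α
eCoeff-insertPart     i []      α = refl
eCoeff-insertPart {K} i (m ∷ μ) α with m ≤ᵇ i
... | true  = refl
... | false = trans (eCoeff-∷ m (insertPart i μ) α)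
  (trans (∑-cong (subsets K) (λ S → cong (when _) (eCoeff-insertPart i μ (α ∸ˢ S))))
  (trans (sym (eCoeff-∷ m (i ∷ μ) α)) (eCoeff-swap m i μ α)))

-- A formal linear combination Σ c_λ e_λ, listed as pairs (c_λ, λ) with repetitions allowed.
Combination : Set → Set
Combination A = List (A × List ℕ)

evalℕ : ∀ {K} → Combination ℕ → (Fin K → ℕ) → ℕ
evalℕ L β = ∑ L (λ (c , μ) → c * eCoeff μ β)

-- Multiplication by w · e_i.
scaleInsert : ℕ → ℕ → Combination ℕ → Combination ℕ
scaleInsert w i = map (λ (c , μ) → (w * c , insertPart i μ))

-- The e-expansion of X_{P_M} read off from smirnov-recursion; the first argument is fuel (at least M).
pathExpansionF : ℕ → ℕ → Combination ℕ
pathExpansionF _       zero    = (1 , []) ∷ []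
pathExpansionF zero    (suc M) = []
pathExpansionF (suc f) (suc M) =
  (1 , suc M ∷ []) ∷ concatMap (λ i → scaleInsert (i ∸ 1) i (pathExpansionF f (suc M ∸ i))) (downFrom⁺ (suc M))

pathExpansion : ℕ → Combination ℕ
pathExpansion M = pathExpansionF M M

evalℕ-scaleInsert : ∀ {K} w i L (β : Fin K → ℕ) →
  evalℕ (scaleInsert w i L) β ≡ w * ∑ (subsets K) (λ S → when ((size S ≡ᵇ i) ∧ supports β S) (evalℕ L (β ∸ˢ S)))
evalℕ-scaleInsert {K} w i L β = begin
  evalℕ (scaleInsert w i L) β
    ≡⟨ ∑-map L _ _ ⟩
  ∑ L (λ (c , μ) → (w * c) * eCoeff (insertPart i μ) β)
    ≡⟨ ∑-cong L (λ (c , μ) → trans (*-assoc w c _) (cong (λ x → w * (c * x)) (eCoeff-insertPart i μ β))) ⟩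
  ∑ L (λ (c , μ) → w * (c * eCoeff (i ∷ μ) β))
    ≡⟨ *-distribˡ-∑ L w _ ⟩
  w * ∑ L (λ (c , μ) → c * eCoeff (i ∷ μ) β)
    ≡⟨ cong (w *_) (∑-cong L (λ (c , μ) → trans (cong (c *_) (eCoeff-∷ i μ β)) (sym (*-distribˡ-∑ (subsets K) c _)))) ⟩
  w * ∑ L (λ (c , μ) → ∑ (subsets K) (λ S → c * when ((size S ≡ᵇ i) ∧ supports β S) (eCoeff μ (β ∸ˢ S))))
    ≡⟨ cong (w *_) (∑-comm L (subsets K) _) ⟩
  w * ∑ (subsets K) (λ S → ∑ L (λ (c , μ) → c * when ((size S ≡ᵇ i) ∧ supports β S) (eCoeff μ (β ∸ˢ S))))
    ≡⟨ cong (w *_) (∑-cong (subsets K) (λ S → trans (∑-cong L (λ (c , μ) → *-when c _ _)) (∑-when L _ _))) ⟩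
  w * ∑ (subsets K) (λ S → when ((size S ≡ᵇ i) ∧ supports β S) (evalℕ L (β ∸ˢ S))) ∎
  where open ≡-Reasoning

evalℕ-pathExpansionF : ∀ {K} f M → M ≤ f → (β : Fin K → ℕ) → evalℕ (pathExpansionF f M) β ≡ smirnov M β nothing
evalℕ-pathExpansionF     f       zero    _         β = trans (+-identityʳ _) (+-identityʳ _)
evalℕ-pathExpansionF {K} (suc f) (suc M) (s≤s M≤f) β = begin
  evalℕ (pathExpansionF (suc f) (suc M)) β
    ≡⟨ cong₂ _+_ (+-identityʳ (eCoeff (suc M ∷ []) β))
                 (∑-concatMap (downFrom⁺ (suc M)) (λ i → scaleInsert (i ∸ 1) i (pathExpansionF f (suc M ∸ i))) (λ (c , μ) → c * eCoeff μ β)) ⟩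
  eCoeff (suc M ∷ []) β + ∑ (downFrom⁺ (suc M)) (λ i → evalℕ (scaleInsert (i ∸ 1) i (pathExpansionF f (suc M ∸ i))) β)
    ≡⟨ cong (_+_ (eCoeff (suc M ∷ []) β)) (∑-cong (downFrom⁺ (suc M)) term) ⟩
  _ ≡⟨ smirnov-recursion (suc M) β ⟨
  smirnov (suc M) β nothing ∎
  where
  open ≡-Reasoning
  term : ∀ i → evalℕ (scaleInsert (i ∸ 1) i (pathExpansionF f (suc M ∸ i))) β
               ≡ (i ∸ 1) * ∑ (subsets K) (λ S → when ((size S ≡ᵇ i) ∧ supports β S) (smirnov (suc M ∸ i) (β ∸ˢ S) nothing))
  term zero    = evalℕ-scaleInsert 0 0 (pathExpansionF f (suc M)) β
  term (suc i) = trans (evalℕ-scaleInsert i (suc i) (pathExpansionF f (M ∸ i)) β) (cong (i *_) (∑-cong (subsets K) (λ S →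
    cong (when _) (evalℕ-pathExpansionF f (M ∸ i) (≤-trans (m∸n≤m M i) M≤f) (β ∸ˢ S)))))

-- The lariat identity

module _ {K : ℕ} (β : Fin K → ℕ) (G : (Fin K → ℕ) → ℕ) (G-cong : ∀ {γ δ} → γ ≗ δ → G γ ≡ G δ) where

  size-*-when : ∀ k S x c → size S * when ((size S ≡ᵇ k) ∧ c) x ≡ k * when ((size {K} S ≡ᵇ k) ∧ c) x
  size-*-when k S x c with size S ≡ᵇ k in e
  ... | true rewrite ≡ᵇ-true⇒≡ (size S) k e = refl
  ... | false = trans (*-zeroʳ (size S)) (sym (*-zeroʳ k))

  twoSubsetTerm : (Fin K → Bool) → ℕ
  twoSubsetTerm S = when ((size S ≡ᵇ 2) ∧ supports β S) (G (β ∸ˢ S))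

  oneSubsetTerm : Fin K → (Fin K → Bool) → ℕ
  oneSubsetTerm a S = when (not (S a)) (when ((size S ≡ᵇ 1) ∧ ((0 <ᵇ β a) ∧ supports β S)) (G (β ∸ˢ S ∸[ a ])))

  emptySubsetTerm : Fin K → Fin K → (Fin K → Bool) → ℕ
  emptySubsetTerm a b S = when (not (S b)) (oneSubsetTerm a (include b S))

  twoSubsetTerm-ext : Extensional twoSubsetTerm
  twoSubsetTerm-ext {S} {T} S≗T rewrite countFin-cong K S≗T | supports-cong β S≗T = cong (when _) (G-cong (∸ˢ-cong β S≗T))

  oneSubsetTerm-ext : ∀ a → Extensional (oneSubsetTerm a)
  oneSubsetTerm-ext a {S} {T} S≗T rewrite S≗T a | countFin-cong K S≗T | supports-cong β S≗T =
    cong (λ x → when (not (T a)) (when _ x)) (G-cong (∸[]-cong a (∸ˢ-cong β S≗T)))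

  emptySubsetTerm-ext : ∀ a b → Extensional (emptySubsetTerm a b)
  emptySubsetTerm-ext a b S≗T = cong₂ (λ u → when (not u)) (S≗T b) (oneSubsetTerm-ext a (λ i → cong ((b =ᶠ i) ∨_) (S≗T i)))

  twoSubsetTerm-include : ∀ a S → when (not (S a)) (twoSubsetTerm (include a S)) ≡ oneSubsetTerm a S
  twoSubsetTerm-include a S with S a in Sa
  ... | true  = refl
  ... | false rewrite size-include S a Sa | supports-include β S a Sa = cong (when _) (G-cong (∸ˢ-include β S a Sa))

  oneSubsetTerm-size : ∀ a S → oneSubsetTerm a S ≡ size S * oneSubsetTerm a S
  oneSubsetTerm-size a S with S a
  ... | true  = sym (*-zeroʳ (size S))
  ... | false = sym (trans (size-*-when 1 S _ _) (+-identityʳ _))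

  emptySubsetTerm-size : ∀ a b S → emptySubsetTerm a b S ≡ when (size S ≡ᵇ 0) (emptySubsetTerm a b S)
  emptySubsetTerm-size a b S with S b in Sb
  ... | true  = sym (when-ε _)
  ... | false rewrite size-include S b Sb with size S
  ...   | zero  = refl
  ...   | suc n = when-ε (not ((b =ᶠ a) ∨ S a))

  emptySubsetTerm-∅ : ∀ a b → emptySubsetTerm a b ∅ ≡ when (not (b =ᶠ a)) (when ((0 <ᵇ β a) ∧ (0 <ᵇ β b)) (G (β ∸[ b ] ∸[ a ])))
  emptySubsetTerm-∅ a b rewrite size-include ∅ b refl | size-∅ {K} | supports-include β ∅ b refl | supports-∅ β
                               | ∨-identityʳ (b =ᶠ a) | ∧-identityʳ (0 <ᵇ β b) =
    cong (λ x → when (not (b =ᶠ a)) (when ((0 <ᵇ β a) ∧ (0 <ᵇ β b)) x)) (G-cong (∸[]-cong a (∸ˢ-include β ∅ b refl)))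

  -- Each 2-subset {a, b} of the support of β arises from the two ordered pairs (a, b) and (b, a).
  ∑-twoSubsets : 2 * ∑ (subsets K) twoSubsetTerm
    ≡ ∑ (allFin K) (λ a → ∑ (allFin K) (λ b → when (not (a =ᶠ b) ∧ ((0 <ᵇ β a) ∧ (0 <ᵇ β b))) (G (β ∸[ a ] ∸[ b ]))))
  ∑-twoSubsets = begin
    2 * ∑ (subsets K) twoSubsetTerm
      ≡⟨ *-distribˡ-∑ (subsets K) 2 twoSubsetTerm ⟨
    ∑ (subsets K) (λ S → 2 * twoSubsetTerm S)
      ≡⟨ ∑-cong (subsets K) (λ S → size-*-when 2 S _ _) ⟨
    ∑ (subsets K) (λ S → size S * twoSubsetTerm S)
      ≡⟨ ∑-size-* K twoSubsetTerm twoSubsetTerm-ext ⟩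
    ∑ (allFin K) (λ a → ∑ (subsets K) (λ S → when (not (S a)) (twoSubsetTerm (include a S))))
      ≡⟨ ∑-cong (allFin K) (λ a → ∑-cong (subsets K) (twoSubsetTerm-include a)) ⟩
    ∑ (allFin K) (λ a → ∑ (subsets K) (oneSubsetTerm a))
      ≡⟨ ∑-cong (allFin K) (λ a → trans (∑-cong (subsets K) (oneSubsetTerm-size a)) (∑-size-* K (oneSubsetTerm a) (oneSubsetTerm-ext a))) ⟩
    ∑ (allFin K) (λ a → ∑ (allFin K) (λ b → ∑ (subsets K) (emptySubsetTerm a b)))
      ≡⟨ ∑-cong (allFin K) (λ a → ∑-cong (allFin K) (λ b → trans (∑-cong (subsets K) (emptySubsetTerm-size a b))
           (trans (∑-subsets-∅ K (emptySubsetTerm a b) (emptySubsetTerm-ext a b)) (emptySubsetTerm-∅ a b)))) ⟩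
    ∑ (allFin K) (λ a → ∑ (allFin K) (λ b → when (not (b =ᶠ a)) (when ((0 <ᵇ β a) ∧ (0 <ᵇ β b)) (G (β ∸[ b ] ∸[ a ])))))
      ≡⟨ ∑-comm (allFin K) (allFin K) _ ⟩
    ∑ (allFin K) (λ b → ∑ (allFin K) (λ a → when (not (b =ᶠ a)) (when ((0 <ᵇ β a) ∧ (0 <ᵇ β b)) (G (β ∸[ b ] ∸[ a ])))))
      ≡⟨ ∑-cong (allFin K) (λ b → ∑-cong (allFin K) (λ a → merge (not (b =ᶠ a)) (0 <ᵇ β a) (0 <ᵇ β b) _)) ⟩
    ∑ (allFin K) (λ b → ∑ (allFin K) (λ a → when (not (b =ᶠ a) ∧ ((0 <ᵇ β b) ∧ (0 <ᵇ β a))) (G (β ∸[ b ] ∸[ a ])))) ∎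
    where
    open ≡-Reasoning
    merge : ∀ u v w (x : ℕ) → when u (when (v ∧ w) x) ≡ when (u ∧ (w ∧ v)) x
    merge false v w x = refl
    merge true  v w x = cong (λ c → when c x) (∧-comm v w)

module _ {K : ℕ} (M : ℕ) (β : Fin K → ℕ) where

  -- The coefficient of x^β in e₂ X_{P_{M+1}}.
  e₂Term : ℕ
  e₂Term = ∑ (subsets K) (λ S → when ((size S ≡ᵇ 2) ∧ supports β S) (smirnov (suc M) (β ∸ˢ S) nothing))

  distinctInSupport : Fin K → Fin K → Bool
  distinctInSupport a b = not (a =ᶠ b) ∧ ((0 <ᵇ β a) ∧ (0 <ᵇ β b))

  -- Pairs a ≠ b followed by a Smirnov word that starts with b.
  secondRepeated : ℕ
  secondRepeated = ∑ (allFin K) (λ a → ∑ (allFin K) (λ b →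
    when (distinctInSupport a b) (smirnovFrom (suc M) (β ∸[ a ] ∸[ b ]) b)))

  -- Smirnov words x y x w of length M + 3 and content β.
  thirdEqualsFirst : ℕ
  thirdEqualsFirst = ∑ (allFin K) (λ x → when (0 <ᵇ β x) (∑ (allFin K) (λ y →
    when (not (x =ᶠ y) ∧ (0 <ᵇ (β ∸[ x ]) y)) (thirdIsFirst x y))))
    where
    thirdIsFirst : Fin K → Fin K → ℕ
    thirdIsFirst x y = when (not (y =ᶠ x) ∧ (0 <ᵇ (β ∸[ x ] ∸[ y ]) x)) (smirnov M (β ∸[ x ] ∸[ y ] ∸[ x ]) (just x))

  e₂Term-split : 2 * e₂Term ≡ ∑ (allFin K) (λ a → ∑ (allFin K) (λ b →
    when (distinctInSupport a b) (smirnov (suc M) (β ∸[ a ] ∸[ b ]) (just b)))) + secondRepeated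
  e₂Term-split = trans (∑-twoSubsets β (λ γ → smirnov (suc M) γ nothing) (smirnov-cong (suc M) nothing))
    (trans (∑-cong (allFin K) (λ a → trans (∑-cong (allFin K) (λ b →
        trans (cong (when (distinctInSupport a b)) (smirnov-nothing (suc M) _ b)) (when-distrib (distinctInSupport a b) _ _)))
      (∑-distrib (allFin K) _ _))) (∑-distrib (allFin K) _ _))

  smirnov-first-two-letters : ∑ (allFin K) (λ a → ∑ (allFin K) (λ b →
    when (distinctInSupport a b) (smirnov (suc M) (β ∸[ a ] ∸[ b ]) (just b)))) ≡ smirnov (3 + M) β nothing
  smirnov-first-two-letters = ∑-cong (allFin K) (λ x → trans (∑-cong (allFin K) (guards x)) (∑-when (allFin K) (0 <ᵇ β x) _))
    where
    guards : ∀ x y → when (distinctInSupport x y) (smirnov (suc M) (β ∸[ x ] ∸[ y ]) (just y))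
             ≡ when (0 <ᵇ β x) (when (not (x =ᶠ y) ∧ (0 <ᵇ (β ∸[ x ]) y)) (smirnov (suc M) (β ∸[ x ] ∸[ y ]) (just y)))
    guards x y with x =ᶠ y
    ... | true  = sym (when-ε _)
    ... | false = when-∧ (0 <ᵇ β x) (0 <ᵇ β y) _

  smirnov-by-third-letter : smirnov (3 + M) β nothing ≡ lariatCount M β + thirdEqualsFirst
  smirnov-by-third-letter = trans (∑-cong (allFin K) (λ x →
      trans (cong (when (0 <ᵇ β x)) (trans (∑-cong (allFin K) (λ y →
        trans (cong (when (second x y)) (third-letter x y)) (when-distrib (second x y) _ _))) (∑-distrib (allFin K) _ _)))
      (when-distrib (0 <ᵇ β x) _ _)))
    (∑-distrib (allFin K) _ _)
    where
    second : Fin K → Fin K → Bool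
    second x y = not (x =ᶠ y) ∧ (0 <ᵇ (β ∸[ x ]) y)
    word : Fin K → Fin K → Fin K → ℕ
    word x y z = when (not (y =ᶠ z) ∧ (0 <ᵇ (β ∸[ x ] ∸[ y ]) z)) (smirnov M (β ∸[ x ] ∸[ y ] ∸[ z ]) (just z))
    third-letter : ∀ x y → smirnov (suc M) (β ∸[ x ] ∸[ y ]) (just y)
      ≡ ∑ (allFin K) (lariatTail M β x y) + word x y x
    third-letter x y = trans (∑-cong (allFin K) split) (trans (∑-distrib (allFin K) _ _) (cong (_+_ _) (∑-δ K x (word x y))))
      where
      split : ∀ z → word x y z ≡ lariatTail M β x y z + when (x =ᶠ z) (word x y z)
      split z with x =ᶠ z
      ... | true  rewrite ∧-zeroʳ (not (y =ᶠ z)) = refl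
      ... | false rewrite ∧-identityʳ (not (y =ᶠ z)) = sym (+-identityʳ _)

  -- The word a b (b w) with a ≠ b corresponds to the word b a b w.
  thirdEqualsFirst≡secondRepeated : thirdEqualsFirst ≡ secondRepeated
  thirdEqualsFirst≡secondRepeated =
    trans (∑-cong (allFin K) (λ x → trans (sym (∑-when (allFin K) (0 <ᵇ β x) _)) (∑-cong (allFin K) (relabel x))))
          (∑-comm (allFin K) (allFin K) _)
    where
    relabel : ∀ x y → when (0 <ᵇ β x) (when (not (x =ᶠ y) ∧ (0 <ᵇ (β ∸[ x ]) y))
                        (when (not (y =ᶠ x) ∧ (0 <ᵇ (β ∸[ x ] ∸[ y ]) x)) (smirnov M (β ∸[ x ] ∸[ y ] ∸[ x ]) (just x))))
                      ≡ when (distinctInSupport y x) (smirnovFrom (suc M) (β ∸[ y ] ∸[ x ]) x)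
    relabel x y with x =ᶠ y in e
    ... | true rewrite trans (=ᶠ-sym y x) e = when-ε _
    ... | false rewrite trans (=ᶠ-sym y x) e =
      trans (cong (λ v → when (0 <ᵇ β x) (when (0 <ᵇ β y) (when (0 <ᵇ β x ∸ δ x x) v))) (smirnov-cong M (just x) (∸[]-cong x ∸[]-comm)))
            (regroup (0 <ᵇ β x) (0 <ᵇ β y) (0 <ᵇ β x ∸ δ x x) _)
      where
      ∸[]-comm : β ∸[ x ] ∸[ y ] ≗ β ∸[ y ] ∸[ x ]
      ∸[]-comm i = trans (∸-+-assoc (β i) (δ x i) (δ y i))
        (trans (cong (β i ∸_) (+-comm (δ x i) (δ y i))) (sym (∸-+-assoc (β i) (δ y i) (δ x i))))
      regroup : ∀ p q r (t : ℕ) → when p (when q (when r t)) ≡ when (q ∧ p) (when r t)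
      regroup true  true  r t = refl
      regroup true  false r t = refl
      regroup false true  r t = refl
      regroup false false r t = refl

  lariat-identity : lariatCount M β + 2 * e₂Term ≡ 2 * smirnov (3 + M) β nothing
  lariat-identity = begin
    lariatCount M β + 2 * e₂Term
      ≡⟨ cong (_+_ (lariatCount M β)) (trans e₂Term-split
           (cong₂ _+_ smirnov-first-two-letters (sym thirdEqualsFirst≡secondRepeated))) ⟩
    lariatCount M β + (P + thirdEqualsFirst)  ≡⟨ cong (_+_ (lariatCount M β)) (+-comm P thirdEqualsFirst) ⟩
    lariatCount M β + (thirdEqualsFirst + P)  ≡⟨ +-assoc (lariatCount M β) thirdEqualsFirst P ⟨
    lariatCount M β + thirdEqualsFirst + P    ≡⟨ cong (_+ P) smirnov-by-third-letter ⟨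
    P + P                                     ≡⟨ cong (_+_ P) (+-identityʳ P) ⟨
    2 * P                                     ∎
    where
    open ≡-Reasoning
    P : ℕ
    P = smirnov (3 + M) β nothing

-- Linear independence of the e_λ

_≤ₗ_ : List ℕ → List ℕ → Set
_≤ₗ_ = Lex-≤ _≡_ _<_

≤ₗ-refl : ∀ μ → μ ≤ₗ μ
≤ₗ-refl []      = base _
≤ₗ-refl (p ∷ μ) = next refl (≤ₗ-refl μ)

≤ₗ-trans : ∀ {λ₁ λ₂ λ₃} → λ₁ ≤ₗ λ₂ → λ₂ ≤ₗ λ₃ → λ₁ ≤ₗ λ₃
≤ₗ-trans = lex-transitive isEquivalence (resp₂ _<_) <-trans

data Partition≤ : ℕ → List ℕ → Set where
  []   : ∀ {b} → Partition≤ b []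
  cons : ∀ {b p ps} → 1 ≤ p → p ≤ b → Partition≤ p ps → Partition≤ b (p ∷ ps)

Partition≤-weaken : ∀ {b c ps} → b ≤ c → Partition≤ b ps → Partition≤ c ps
Partition≤-weaken b≤c []               = []
Partition≤-weaken b≤c (cons 1≤p p≤b ps) = cons 1≤p (≤-trans p≤b b≤c) ps

partsAbove : ℕ → List ℕ → ℕ
partsAbove j []       = 0
partsAbove j (p ∷ ps) = when (j <ᵇ p) 1 + partsAbove j ps

partsAbove-bound : ∀ {b} j ps → Partition≤ b ps → b ≤ j → partsAbove j ps ≡ 0
partsAbove-bound j []       []                  b≤j = refl
partsAbove-bound j (p ∷ ps) (cons _ p≤b ps-bounded) b≤j
  rewrite ≤⇒>ᵇ-false p j (≤-trans p≤b b≤j) = partsAbove-bound j ps ps-bounded (≤-trans p≤b b≤j)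

-- The exponent vector of x^{ν′} for the conjugate partition ν′: the exponent of x_j is the number of parts above j.
conjugate : ∀ {K} → List ℕ → Fin K → ℕ
conjugate ν j = partsAbove (toℕ j) ν

b2n≡when : ∀ b → b2n b ≡ when b 1
b2n≡when true  = refl
b2n≡when false = refl

module _ {K : ℕ} (γ : Fin K → ℕ) (p : ℕ) (p≤K : p ≤ K) (supp≡below : ∀ i → (0 <ᵇ γ i) ≡ below p i) where

  supports⇒⊆below : ∀ S → supports γ S ≡ true → ∀ i → S i ≡ true → below p i ≡ true
  supports⇒⊆below S h i Si = subst (λ b → (not b ∨ below p i) ≡ true) Si
    (trans (cong (not (S i) ∨_) (sym (supp≡below i))) (andFin-true⇒ K _ h i))

  -- When the support of γ is {0, …, p - 1}, a factor e_k with k > p cannot fit ...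
  eCoeff-large-part : ∀ k μ → p < k → eCoeff (k ∷ μ) γ ≡ 0
  eCoeff-large-part k μ p<k = trans (eCoeff-∷ k μ γ) (trans (∑-cong (subsets K) vanishes) (∑-ε (subsets K)))
    where
    size<k : ∀ S → supports γ S ≡ true → size S < k
    size<k S sup = ≤-<-trans (size-mono S (below p) (supports⇒⊆below S sup)) (subst (_< k) (sym (size-below K p p≤K)) p<k)
    vanishes : ∀ S → when ((size S ≡ᵇ k) ∧ supports γ S) (eCoeff μ (γ ∸ˢ S)) ≡ 0
    vanishes S with supports γ S in sup
    ... | false rewrite ∧-zeroʳ (size S ≡ᵇ k) = refl
    ... | true  rewrite ≢⇒≡ᵇ-false (size S) k (<⇒≢ (size<k S sup)) = refl

  -- ... and a factor e_p must use up the whole support.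
  eCoeff-full-part : ∀ μ → eCoeff (p ∷ μ) γ ≡ eCoeff μ (γ ∸ˢ below p)
  eCoeff-full-part μ = trans (eCoeff-∷ p μ γ) (trans (∑-cong (subsets K) (λ S → cong (λ b → when b (eCoeff μ (γ ∸ˢ S))) (is-below S)))
    (∑-subsets-single K (below p) (λ S → eCoeff μ (γ ∸ˢ S)) (λ S≗T → eCoeff-cong μ (∸ˢ-cong γ S≗T))))
    where
    is-below : ∀ S → ((size S ≡ᵇ p) ∧ supports γ S) ≡ sameSubset S (below p)
    is-below S = ⇔→≡ (mk⇔ to from)
      where
      to : ((size S ≡ᵇ p) ∧ supports γ S) ≡ true → sameSubset S (below p) ≡ true
      to h = ⇒andFin-true K _ same
        where
        S⊆below : ∀ i → S i ≡ true → below p i ≡ true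
        S⊆below = supports⇒⊆below S (∧-trueʳ {size S ≡ᵇ p} h)
        below⊆S : ∀ i → below p i ≡ true → S i ≡ true
        below⊆S = ⊆⇒⊇ K S (below p) S⊆below (≤-reflexive (trans (size-below K p p≤K) (sym (≡ᵇ-true⇒≡ _ _ (∧-trueˡ h)))))
        same : ∀ i → (S i ⇔ᵇ below p i) ≡ true
        same i with S i in Si | below p i in belowᵢ
        ... | true  | true  = refl
        ... | false | false = refl
        ... | true  | false = trans (sym belowᵢ) (S⊆below i Si)
        ... | false | true  = trans (sym Si) (below⊆S i belowᵢ)
      from : sameSubset S (below p) ≡ true → ((size S ≡ᵇ p) ∧ supports γ S) ≡ true
      from h = ∧-true (≡⇒≡ᵇ-true _ _ (trans (countFin-cong K S≗below) (size-below K p p≤K)))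
                      (⇒andFin-true K _ (λ i → subst (λ b → (not b ∨ (0 <ᵇ γ i)) ≡ true) (sym (S≗below i))
                                                  (trans (cong (not (below p i) ∨_) (supp≡below i)) (excluded-middle (below p i)))))
        where
        S≗below : S ≗ below p
        S≗below i = ⇔ᵇ-true⇒≡ _ _ (andFin-true⇒ K _ h i)
        excluded-middle : ∀ b → (not b ∨ b) ≡ true
        excluded-middle true  = refl
        excluded-middle false = refl

module _ {K : ℕ} where

  supp-conjugate : ∀ p ν → Partition≤ p ν → ∀ i → (0 <ᵇ conjugate {K} (p ∷ ν) i) ≡ below p i
  supp-conjugate p ν ν≤p i with toℕ i <ᵇ p in e
  ... | true  = refl
  ... | false = cong (0 <ᵇ_) (partsAbove-bound (toℕ i) ν ν≤p (≮⇒≥ (λ i<p → true≢false (trans (sym (<⇒<ᵇ-true _ _ i<p)) e))))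

  conjugate-∸ˢ-below : ∀ p ν → conjugate {K} (p ∷ ν) ∸ˢ below p ≗ conjugate ν
  conjugate-∸ˢ-below p ν i = trans (cong (partsAbove (toℕ i) (p ∷ ν) ∸_) (b2n≡when (toℕ i <ᵇ p))) (m+n∸m≡n (when (toℕ i <ᵇ p) 1) _)

  eCoeff-conjugate-self : ∀ ν → Partition≤ K ν → eCoeff ν (conjugate {K} ν) ≡ 1
  eCoeff-conjugate-self []      []                   = cong (λ b → when b 1) (⇒andFin-true K _ (λ i → refl))
  eCoeff-conjugate-self (p ∷ ν) (cons _ p≤K ν-bounded) =
    trans (eCoeff-full-part (conjugate (p ∷ ν)) p p≤K (supp-conjugate p ν ν-bounded) ν)
      (trans (eCoeff-cong ν (conjugate-∸ˢ-below p ν)) (eCoeff-conjugate-self ν (Partition≤-weaken p≤K ν-bounded)))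

  eCoeff-conjugate-lex : ∀ ν μ → Partition≤ K ν → Partition≤ K μ → ν ≤ₗ μ → μ ≢ ν → eCoeff μ (conjugate {K} ν) ≡ 0
  eCoeff-conjugate-lex []      []      _ _ (base _) μ≢ν = ⊥-elim (μ≢ν refl)
  eCoeff-conjugate-lex []      (k ∷ μ) _ (cons 1≤k _ _) halt _ =
    eCoeff-large-part (conjugate {K} []) 0 z≤n (λ i → refl) k μ 1≤k
  eCoeff-conjugate-lex (p ∷ ν) (k ∷ μ) (cons _ p≤K ν-bounded) _ (this p<k) _ =
    eCoeff-large-part (conjugate (p ∷ ν)) p p≤K (supp-conjugate p ν ν-bounded) k μ p<k
  eCoeff-conjugate-lex (p ∷ ν) (p ∷ μ) (cons _ p≤K ν-bounded) (cons _ _ μ-bounded) (next refl ν≤μ) μ≢ν =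
    trans (eCoeff-full-part (conjugate (p ∷ ν)) p p≤K (supp-conjugate p ν ν-bounded) μ)
      (trans (eCoeff-cong μ (conjugate-∸ˢ-below p ν))
        (eCoeff-conjugate-lex ν μ (Partition≤-weaken p≤K ν-bounded) (Partition≤-weaken p≤K μ-bounded) ν≤μ (μ≢ν ∘ cong (p ∷_))))

_≟ₗ_ : DecidableEquality (List ℕ)
_≟ₗ_ = ≡-dec _≟_

_=ˡ_ : List ℕ → List ℕ → Bool
μ =ˡ ν = does (μ ≟ₗ ν)

evalℤ : ∀ {K} → Combination ℤ → (Fin K → ℕ) → ℤ
evalℤ L α = ∑ℤ.∑ L (λ (c , μ) → c *ℤ + eCoeff μ α)

coeffℤ : List ℕ → Combination ℤ → ℤ
coeffℤ ν L = ∑ℤ.∑ L (λ (c , μ) → ∑ℤ.when (μ =ˡ ν) c)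

minKey : {A : Set} → List ℕ → Combination A → List ℕ
minKey m []            = m
minKey m ((_ , μ) ∷ L) with lex-total sym <-cmp m μ
... | inj₁ _ = minKey m L
... | inj₂ _ = minKey μ L

minKey-attained : {A : Set} (P : List ℕ → Set) → ∀ m (L : Combination A) → P m → All (P ∘ proj₂) L → P (minKey m L)
minKey-attained P m []            Pm []          = Pm
minKey-attained P m ((_ , μ) ∷ L) Pm (Pμ ∷ PL) with lex-total sym <-cmp m μ
... | inj₁ _ = minKey-attained P m L Pm PL
... | inj₂ _ = minKey-attained P μ L Pμ PL

minKey-least : {A : Set} → ∀ m (L : Combination A) → minKey m L ≤ₗ m × All (λ (_ , μ) → minKey m L ≤ₗ μ) L
minKey-least m []            = ≤ₗ-refl m , []
minKey-least m ((_ , μ) ∷ L) with lex-total sym <-cmp m μ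
... | inj₁ m≤μ = let (min≤m , min≤L) = minKey-least m L in min≤m , ≤ₗ-trans min≤m m≤μ ∷ min≤L
... | inj₂ μ≤m = let (min≤μ , min≤L) = minKey-least μ L in ≤ₗ-trans min≤μ μ≤m , min≤μ ∷ min≤L

keys-present : {A : Set} (L : Combination A) → All (λ (_ , μ) → Any (λ (_ , μ′) → μ′ ≡ μ) L) L
keys-present []      = []
keys-present (q ∷ L) = here refl ∷ All.map there (keys-present L)

dropKey : List ℕ → Combination ℤ → Combination ℤ
dropKey m = filter (λ (_ , μ) → ¬? (μ ≟ₗ m))

evalℤ-dropKey : ∀ {K} m L (α : Fin K → ℕ) → evalℤ L α ≡ evalℤ (dropKey m L) α +ℤ coeffℤ m L *ℤ + eCoeff m α
evalℤ-dropKey m []            α = refl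
evalℤ-dropKey m ((c , μ) ∷ L) α with μ ≟ₗ m
... | yes refl rewrite evalℤ-dropKey m L α =
  solve 4 (λ c E D C → c :* E :+ (D :+ C :* E) := D :+ (c :+ C) :* E) refl c (+ eCoeff m α) (evalℤ (dropKey m L) α) (coeffℤ m L)
  where open ℤ-Solver.+-*-Solver
... | no _ rewrite evalℤ-dropKey m L α =
  solve 4 (λ x E D C → x :+ (D :+ C :* E) := (x :+ D) :+ (con (+ 0) :+ C) :* E) refl
          (c *ℤ + eCoeff μ α) (+ eCoeff m α) (evalℤ (dropKey m L) α) (coeffℤ m L)
  where open ℤ-Solver.+-*-Solver

coeffℤ-dropKey : ∀ m ν L → ν ≢ m → coeffℤ ν L ≡ coeffℤ ν (dropKey m L)
coeffℤ-dropKey m ν []            ν≢m = refl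
coeffℤ-dropKey m ν ((c , μ) ∷ L) ν≢m with μ ≟ₗ m
... | yes refl rewrite dec-false (m ≟ₗ ν) (ν≢m ∘ sym) = trans (ℤ.+-identityˡ _) (coeffℤ-dropKey m ν L ν≢m)
... | no _ = cong (_+ℤ_ (∑ℤ.when (μ =ˡ ν) c)) (coeffℤ-dropKey m ν L ν≢m)

module _ {K : ℕ} where

  evalℤ-conjugate-min : ∀ m L → Partition≤ K m → All (Partition≤ K ∘ proj₂) L → All (λ (_ , μ) → m ≤ₗ μ) L →
                        evalℤ L (conjugate {K} m) ≡ coeffℤ m L
  evalℤ-conjugate-min m []            _ []            []            = refl
  evalℤ-conjugate-min m ((c , μ) ∷ L) m-bounded (μ-bounded ∷ L-bounded) (m≤μ ∷ m≤L) =
    cong₂ _+ℤ_ term (evalℤ-conjugate-min m L m-bounded L-bounded m≤L)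
    where
    term : c *ℤ + eCoeff μ (conjugate m) ≡ ∑ℤ.when (μ =ˡ m) c
    term with μ ≟ₗ m
    ... | yes refl = trans (cong (λ x → c *ℤ + x) (eCoeff-conjugate-self m m-bounded)) (ℤ.*-identityʳ c)
    ... | no μ≢m   = trans (cong (λ x → c *ℤ + x) (eCoeff-conjugate-lex m μ m-bounded μ-bounded m≤μ μ≢m)) (ℤ.*-zeroʳ c)

  -- The functions e_λ, for λ with parts at most K, are linearly independent: peel off the lexicographically
  -- smallest key m, whose coefficient is the value at the conjugate exponent vector of m.
  coeffℤ-vanishes : ∀ n L → length L ≤ n → All (Partition≤ K ∘ proj₂) L → (∀ α → evalℤ {K} L α ≡ + 0) →
                    ∀ ν → coeffℤ ν L ≡ + 0
  coeffℤ-vanishes n       []            _         _         _   ν = refl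
  coeffℤ-vanishes (suc n) ((c , μ) ∷ L) (s≤s L≤n) L-bounded L≡0 ν = by-key (ν ≟ₗ m)
    where
    m : List ℕ
    m = minKey μ L
    coeff-min : coeffℤ m ((c , μ) ∷ L) ≡ + 0
    coeff-min = let (m≤μ , m≤L) = minKey-least μ L in
      trans (sym (evalℤ-conjugate-min m ((c , μ) ∷ L)
                    (minKey-attained (Partition≤ K) μ L (All.head L-bounded) (All.tail L-bounded)) L-bounded (m≤μ ∷ m≤L)))
            (L≡0 (conjugate m))
    m-present : Any (λ (_ , μ′) → μ′ ≡ m) ((c , μ) ∷ L)
    m-present = minKey-attained (λ k → Any (λ (_ , μ′) → μ′ ≡ k) ((c , μ) ∷ L)) μ L (here refl)
                                (All.map there (keys-present L))
    shorter : length (dropKey m ((c , μ) ∷ L)) ≤ n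
    shorter = ≤-trans (≤-pred (filter-notAll (λ (_ , μ′) → ¬? (μ′ ≟ₗ m)) ((c , μ) ∷ L)
                                              (Any.map (λ μ′≡m μ′≢m → μ′≢m μ′≡m) m-present))) L≤n
    dropped≡0 : ∀ α → evalℤ (dropKey m ((c , μ) ∷ L)) α ≡ + 0
    dropped≡0 α = begin
      D                                          ≡⟨ ℤ.+-identityʳ D ⟨
      D +ℤ + 0                                   ≡⟨ cong (D +ℤ_) (ℤ.*-zeroˡ (+ eCoeff m α)) ⟨
      D +ℤ + 0 *ℤ + eCoeff m α                   ≡⟨ cong (λ x → D +ℤ x *ℤ + eCoeff m α) coeff-min ⟨
      D +ℤ coeffℤ m ((c , μ) ∷ L) *ℤ + eCoeff m α ≡⟨ evalℤ-dropKey m ((c , μ) ∷ L) α ⟨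
      evalℤ ((c , μ) ∷ L) α                      ≡⟨ L≡0 α ⟩
      + 0                                        ∎
      where
      open ≡-Reasoning
      D : ℤ
      D = evalℤ (dropKey m ((c , μ) ∷ L)) α
    by-key : Dec (ν ≡ m) → coeffℤ ν ((c , μ) ∷ L) ≡ + 0
    by-key (yes refl) = coeff-min
    by-key (no ν≢m)   = trans (coeffℤ-dropKey m ν ((c , μ) ∷ L) ν≢m)
      (coeffℤ-vanishes n (dropKey m ((c , μ) ∷ L)) shorter (All.filter⁺ (λ (_ , μ′) → ¬? (μ′ ≟ₗ m)) L-bounded) dropped≡0 ν)

-- Enumeration of partitions

occurrences : List ℕ → List (List ℕ) → ℕ
occurrences ν L = ∑ L (λ μ → when (μ =ˡ ν) 1)

occurrences-map-∷ : ∀ k p ν L → occurrences (p ∷ ν) (map (k ∷_) L) ≡ when (k ≡ᵇ p) (occurrences ν L)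
occurrences-map-∷ k p ν L = trans (∑-map L (k ∷_) _) (trans (∑-cong L (λ μ → when-∧ (k ≡ᵇ p) (μ =ˡ ν) 1)) (∑-when L (k ≡ᵇ p) _))

∑-upTo-suc : ∀ n (h : ℕ → ℕ) → ∑ (upTo (suc n)) h ≡ h 0 + ∑ (upTo n) (h ∘ suc)
∑-upTo-suc n h = cong (_+_ (h 0)) (trans (cong (λ xs → ∑ xs h) (sym (map-applyUpTo id suc n))) (∑-map (upTo n) suc h))

∑-upTo-δ : ∀ n p (G : ℕ → ℕ) → p < n → ∑ (upTo n) (λ i → when (i ≡ᵇ p) (G i)) ≡ G p
∑-upTo-δ (suc n) zero    G _         = trans (∑-upTo-suc n (λ i → when (i ≡ᵇ 0) (G i))) (trans (cong (_+_ (G 0)) (∑-ε (upTo n))) (+-identityʳ _))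
∑-upTo-δ (suc n) (suc p) G (s≤s p<n) = trans (∑-upTo-suc n (λ i → when (i ≡ᵇ suc p) (G i))) (∑-upTo-δ n p (G ∘ suc) p<n)

partsB-bounded : ∀ f n m → All (Partition≤ m) (partsB f n m)
partsB-bounded f       zero    m = [] ∷ []
partsB-bounded zero    (suc n) m = []
partsB-bounded (suc f) (suc n) m = All.concat⁺ (All.map⁺ (All.map⁺ (All.applyUpTo⁺₁ id (suc n ⊓ m) λ {i} i<n⊓m →
  All.map⁺ (All.map (cons (s≤s z≤n) (≤-trans i<n⊓m (m⊓n≤n (suc n) m))) (partsB-bounded f (n ∸ i) (suc i))))))

occurrences-partsB : ∀ f n m ν → n ≤ f → Partition≤ m ν → sumℕ ν ≡ n → occurrences ν (partsB f n m) ≡ 1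
occurrences-partsB f       zero    m []      _ _ _ = refl
occurrences-partsB f       zero    m (p ∷ ν) _ (cons 1≤p _ _) ∑≡0 = ⊥-elim (<⇒≢ (≤-trans 1≤p (m≤m+n p (sumℕ ν))) (sym ∑≡0))
occurrences-partsB (suc f) (suc n) m (suc p ∷ ν) (s≤s n≤f) (cons _ 1+p≤m ν-bounded) ∑≡1+n = begin
  occurrences (suc p ∷ ν) (partsB (suc f) (suc n) m)
    ≡⟨ trans (∑-concatMap (map suc (upTo (suc n ⊓ m))) _ _) (∑-map (upTo (suc n ⊓ m)) suc _) ⟩
  ∑ (upTo (suc n ⊓ m)) (λ i → occurrences (suc p ∷ ν) (map (suc i ∷_) (partsB f (n ∸ i) (suc i))))
    ≡⟨ ∑-cong (upTo (suc n ⊓ m)) (λ i → occurrences-map-∷ (suc i) (suc p) ν (partsB f (n ∸ i) (suc i))) ⟩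
  ∑ (upTo (suc n ⊓ m)) (λ i → when (i ≡ᵇ p) (occurrences ν (partsB f (n ∸ i) (suc i))))
    ≡⟨ ∑-upTo-δ (suc n ⊓ m) p _ (⊓-glb (s≤s p≤n) 1+p≤m) ⟩
  occurrences ν (partsB f (n ∸ p) (suc p))
    ≡⟨ occurrences-partsB f (n ∸ p) (suc p) ν (≤-trans (m∸n≤m n p) n≤f) ν-bounded ∑ν≡n∸p ⟩
  1 ∎
  where
  open ≡-Reasoning
  ∑ν≡n∸p : sumℕ ν ≡ n ∸ p
  ∑ν≡n∸p = trans (sym (m+n∸m≡n p (sumℕ ν))) (cong (_∸ p) (suc-injective ∑≡1+n))
  p≤n : p ≤ n
  p≤n = subst (p ≤_) (suc-injective ∑≡1+n) (m≤m+n p (sumℕ ν))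

IsPartitionOf⇒Partition≤ : ∀ N ν → IsPartitionOf N ν → Partition≤ N ν
IsPartitionOf⇒Partition≤ N ν (∑≡N , positive , decreasing) = go ν positive decreasing (λ { refl → subst (_ ≤_) ∑≡N (m≤m+n _ _) })
  where
  go : ∀ {b} ν → All (1 ≤_) ν → Linked (λ a b → b ≤ a) ν → (∀ {p ps} → ν ≡ p ∷ ps → p ≤ b) → Partition≤ b ν
  go []                _              _         _    = []
  go (p ∷ [])          (1≤p ∷ [])     [-]       head = cons 1≤p (head refl) []
  go (p ∷ q ∷ ν)       (1≤p ∷ 1≤rest) (q≤p ∷ l) head = cons 1≤p (head refl) (go (q ∷ ν) 1≤rest l (λ { refl → q≤p }))

-- Coefficients of X_{P_M}

=ˡ-true⇒≡ : ∀ {μ ν} → (μ =ˡ ν) ≡ true → μ ≡ ν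
=ˡ-true⇒≡ {μ} {ν} e with μ ≟ₗ ν
... | yes μ≡ν = μ≡ν

=ˡ-refl : ∀ μ → (μ =ˡ μ) ≡ true
=ˡ-refl μ = dec-true (μ ≟ₗ μ) refl

_∈ᵇ_ : ℕ → List ℕ → Bool
i ∈ᵇ []      = false
i ∈ᵇ (a ∷ ν) = (i ≡ᵇ a) ∨ (i ∈ᵇ ν)

removePart : ℕ → List ℕ → List ℕ
removePart i []      = []
removePart i (a ∷ ν) = if i ≡ᵇ a then ν else a ∷ removePart i ν

∈ᵇ-true⇒∈ : ∀ i ν → (i ∈ᵇ ν) ≡ true → i ∈ ν
∈ᵇ-true⇒∈ i (a ∷ ν) i∈ν with i ≡ᵇ a in i≟a
... | true  = here (≡ᵇ-true⇒≡ i a i≟a)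
... | false = there (∈ᵇ-true⇒∈ i ν i∈ν)

∉⇒∈ᵇ-false : ∀ i ν → i ∉ ν → (i ∈ᵇ ν) ≡ false
∉⇒∈ᵇ-false i ν i∉ν with i ∈ᵇ ν in i∈ν
... | true  = ⊥-elim (i∉ν (∈ᵇ-true⇒∈ i ν i∈ν))
... | false = refl

removePart-insertPart : ∀ i μ → removePart i (insertPart i μ) ≡ μ
removePart-insertPart i []      rewrite ≡ᵇ-refl i = refl
removePart-insertPart i (m ∷ μ) with m ≤ᵇ i in m≤i
... | true rewrite ≡ᵇ-refl i = refl
... | false rewrite ≢⇒≡ᵇ-false i m (<⇒≢ (≤ᵇ-false⇒> m i m≤i)) = cong (m ∷_) (removePart-insertPart i μ)

∈ᵇ-insertPart : ∀ i μ → (i ∈ᵇ insertPart i μ) ≡ true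
∈ᵇ-insertPart i []      rewrite ≡ᵇ-refl i = refl
∈ᵇ-insertPart i (m ∷ μ) with m ≤ᵇ i
... | true rewrite ≡ᵇ-refl i = refl
... | false rewrite ∈ᵇ-insertPart i μ = ∨-zeroʳ (i ≡ᵇ m)

∈ᵇ⇒≤ : ∀ {b} i ν → Partition≤ b ν → (i ∈ᵇ ν) ≡ true → i ≤ b
∈ᵇ⇒≤ i (a ∷ ν) (cons _ a≤b ν-bounded) i∈ν with i ≡ᵇ a in i≡a
... | true  = subst (_≤ _) (sym (≡ᵇ-true⇒≡ i a i≡a)) a≤b
... | false = ≤-trans (∈ᵇ⇒≤ i ν ν-bounded i∈ν) a≤b

∈ᵇ⇒< : ∀ i a ν → Partition≤ a ν → (i ∈ᵇ ν) ≡ true → (i ≡ᵇ a) ≡ false → i < a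
∈ᵇ⇒< i a ν ν-bounded i∈ν i≢a = ≤∧≢⇒< (∈ᵇ⇒≤ i ν ν-bounded i∈ν) (λ i≡a → true≢false (trans (sym (≡⇒≡ᵇ-true i a i≡a)) i≢a))

insertPart-removePart : ∀ {b} i ν → Partition≤ b ν → (i ∈ᵇ ν) ≡ true → insertPart i (removePart i ν) ≡ ν
insertPart-removePart i (a ∷ ν) (cons _ _ ν-bounded) i∈ν with i ≡ᵇ a in i≟a
... | true rewrite ≡ᵇ-true⇒≡ i a i≟a = insert-head ν ν-bounded
  where
  insert-head : ∀ ν → Partition≤ a ν → insertPart a ν ≡ a ∷ ν
  insert-head []      []                = refl
  insert-head (m ∷ ν) (cons _ m≤a _) rewrite ≤⇒≤ᵇ-true m a m≤a = refl
... | false rewrite >⇒≤ᵇ-false a i (∈ᵇ⇒< i a ν ν-bounded i∈ν i≟a) = cong (a ∷_) (insertPart-removePart i ν ν-bounded i∈ν)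

insertPart-=ˡ : ∀ {b} i μ ν → Partition≤ b ν → (insertPart i μ =ˡ ν) ≡ ((i ∈ᵇ ν) ∧ (μ =ˡ removePart i ν))
insertPart-=ˡ i μ ν ν-bounded = ⇔→≡ (mk⇔ to from)
  where
  to : (insertPart i μ =ˡ ν) ≡ true → ((i ∈ᵇ ν) ∧ (μ =ˡ removePart i ν)) ≡ true
  to e = subst (λ ν′ → ((i ∈ᵇ ν′) ∧ (μ =ˡ removePart i ν′)) ≡ true) (=ˡ-true⇒≡ {insertPart i μ} {ν} e)
               (∧-true (∈ᵇ-insertPart i μ) (subst (λ μ′ → (μ =ˡ μ′) ≡ true) (sym (removePart-insertPart i μ)) (=ˡ-refl μ)))
  from : ((i ∈ᵇ ν) ∧ (μ =ˡ removePart i ν)) ≡ true → (insertPart i μ =ˡ ν) ≡ true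
  from e = subst (λ ν′ → (insertPart i μ =ˡ ν′) ≡ true) (insertPart-removePart i ν ν-bounded (∧-trueˡ e))
                 (subst (λ μ′ → (insertPart i μ′ =ˡ insertPart i (removePart i ν)) ≡ true)
                        (sym (=ˡ-true⇒≡ {μ} {removePart i ν} (∧-trueʳ {i ∈ᵇ ν} e))) (=ˡ-refl (insertPart i (removePart i ν))))

Partition≤-insertPart : ∀ {b} i μ → Partition≤ b μ → 1 ≤ i → i ≤ b → Partition≤ b (insertPart i μ)
Partition≤-insertPart i []      []                  1≤i i≤b = cons 1≤i i≤b []
Partition≤-insertPart i (m ∷ μ) (cons 1≤m m≤b μ-bounded) 1≤i i≤b with m ≤ᵇ i in m≤i
... | true  = cons 1≤i i≤b (cons 1≤m (≤ᵇ-true⇒≤ m i m≤i) μ-bounded)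
... | false = cons 1≤m m≤b (Partition≤-insertPart i μ μ-bounded 1≤i (<⇒≤ (≤ᵇ-false⇒> m i m≤i)))

Partition≤-removePart : ∀ {b} i ν → Partition≤ b ν → Partition≤ b (removePart i ν)
Partition≤-removePart i []      []                      = []
Partition≤-removePart i (a ∷ ν) (cons 1≤a a≤b ν-bounded) with i ≡ᵇ a
... | true  = Partition≤-weaken a≤b ν-bounded
... | false = cons 1≤a a≤b (Partition≤-removePart i ν ν-bounded)

coeffℕ : List ℕ → Combination ℕ → ℕ
coeffℕ ν L = ∑ L (λ (c , μ) → when (μ =ˡ ν) c)

coeffℕ-scaleInsert : ∀ {b} w i L ν → Partition≤ b ν → coeffℕ ν (scaleInsert w i L) ≡ when (i ∈ᵇ ν) (w * coeffℕ (removePart i ν) L)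
coeffℕ-scaleInsert w i L ν ν-bounded = trans (∑-map L _ _) (trans (∑-cong L (λ (c , μ) →
    trans (cong (λ b → when b (w * c)) (insertPart-=ˡ i μ ν ν-bounded))
      (trans (when-∧ (i ∈ᵇ ν) _ _) (cong (when (i ∈ᵇ ν)) (sym (*-when w _ _))))))
  (trans (∑-when L (i ∈ᵇ ν) _) (cong (when (i ∈ᵇ ν)) (*-distribˡ-∑ L w _))))

pathExpansionF-bounded : ∀ f M → All (Partition≤ M ∘ proj₂) (pathExpansionF f M)
pathExpansionF-bounded f       zero    = [] ∷ []
pathExpansionF-bounded zero    (suc M) = []
pathExpansionF-bounded (suc f) (suc M) = cons (s≤s z≤n) ≤-refl [] ∷ All.concat⁺ (All.map⁺ (terms (suc M) ≤-refl))
  where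
  terms : ∀ k → k ≤ suc M →
          All (λ i → All (Partition≤ (suc M) ∘ proj₂) (scaleInsert (i ∸ 1) i (pathExpansionF f (suc M ∸ i)))) (downFrom⁺ k)
  terms zero    _     = []
  terms (suc k) k<1+M =
    All.map⁺ (All.map (λ μ-bounded → Partition≤-insertPart (suc k) _ (Partition≤-weaken (m∸n≤m (suc M) (suc k)) μ-bounded) (s≤s z≤n) k<1+M)
                      (pathExpansionF-bounded f (suc M ∸ suc k)))
    ∷ terms k (≤-trans (n≤1+n k) k<1+M)

pathExpansionF-fuel : ∀ f M → M ≤ f → pathExpansionF f M ≡ pathExpansion M
pathExpansionF-fuel f M M≤f = go f M M M≤f ≤-refl
  where
  go : ∀ f g M → M ≤ f → M ≤ g → pathExpansionF f M ≡ pathExpansionF g M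
  go f       g       zero    _         _         = refl
  go (suc f) (suc g) (suc M) (s≤s M≤f) (s≤s M≤g) = cong ((1 , suc M ∷ []) ∷_) (terms (suc M))
    where
    terms : ∀ k → concatMap (λ i → scaleInsert (i ∸ 1) i (pathExpansionF f (suc M ∸ i))) (downFrom⁺ k)
                  ≡ concatMap (λ i → scaleInsert (i ∸ 1) i (pathExpansionF g (suc M ∸ i))) (downFrom⁺ k)
    terms zero    = refl
    terms (suc k) = cong₂ _++_ (cong (scaleInsert k (suc k)) (go f g (M ∸ k) (≤-trans (m∸n≤m M k) M≤f) (≤-trans (m∸n≤m M k) M≤g))) (terms k)

coeffℕ-pathExpansionF-suc : ∀ {b} f M ν → Partition≤ b ν → coeffℕ ν (pathExpansionF (suc f) (suc M))
  ≡ when ((suc M ∷ []) =ˡ ν) 1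
    + ∑ (downFrom⁺ (suc M)) (λ i → when (i ∈ᵇ ν) ((i ∸ 1) * coeffℕ (removePart i ν) (pathExpansionF f (suc M ∸ i))))
coeffℕ-pathExpansionF-suc f M ν ν-bounded = cong (_+_ (when ((suc M ∷ []) =ˡ ν) 1))
  (trans (∑-concatMap (downFrom⁺ (suc M)) (λ i → scaleInsert (i ∸ 1) i (pathExpansionF f (suc M ∸ i))) (λ (c , μ) → when (μ =ˡ ν) c))
         (∑-cong (downFrom⁺ (suc M)) (λ i → coeffℕ-scaleInsert (i ∸ 1) i (pathExpansionF f (suc M ∸ i)) ν ν-bounded)))

#ones : List ℕ → ℕ
#ones []      = 0
#ones (a ∷ ν) = when (a ≡ᵇ 1) 1 + #ones ν

#ones-removePart : ∀ i ν → (i ≡ᵇ 1) ≡ false → #ones (removePart i ν) ≡ #ones ν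
#ones-removePart i []      _   = refl
#ones-removePart i (a ∷ ν) i≢1 with i ≡ᵇ a in i≟a
... | true rewrite sym (≡ᵇ-true⇒≡ i a i≟a) | i≢1 = refl
... | false = cong (_+_ (when (a ≡ᵇ 1) 1)) (#ones-removePart i ν i≢1)

-- The recursion inserts a part i only with weight i - 1, so a part 1 can only come from the final
-- e_1 = X_{P_1}: no e_λ with two parts 1 occurs.
pathExpansionF-coeff-vanishes : ∀ {b} f M ν → Partition≤ b ν → 2 ≤ #ones ν → coeffℕ ν (pathExpansionF f M) ≡ 0
pathExpansionF-coeff-vanishes f       zero    (a ∷ ν) _ _ = refl
pathExpansionF-coeff-vanishes zero    (suc M) ν       _ _ = refl
pathExpansionF-coeff-vanishes (suc f) (suc M) ν ν-bounded two≤ones =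
  trans (coeffℕ-pathExpansionF-suc f M ν ν-bounded) (cong₂ _+_ single-part (trans (∑-cong (downFrom⁺ (suc M)) term) (∑-ε (downFrom⁺ (suc M)))))
  where
  single-part : when ((suc M ∷ []) =ˡ ν) 1 ≡ 0
  single-part with (suc M ∷ []) =ˡ ν in e
  ... | false = refl
  ... | true with =ˡ-true⇒≡ {suc M ∷ []} {ν} e
  ...   | refl = ⊥-elim (<⇒≱ two≤ones (indicator-≤ (suc M ≡ᵇ 1)))
    where
    indicator-≤ : ∀ b → when b 1 + 0 ≤ 1
    indicator-≤ true  = ≤-refl
    indicator-≤ false = z≤n
  term : ∀ i → when (i ∈ᵇ ν) ((i ∸ 1) * coeffℕ (removePart i ν) (pathExpansionF f (suc M ∸ i))) ≡ 0
  term zero          = when-ε (0 ∈ᵇ ν)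
  term (suc zero)    = when-ε (1 ∈ᵇ ν)
  term (suc (suc k)) rewrite pathExpansionF-coeff-vanishes f (suc M ∸ suc (suc k)) (removePart (suc (suc k)) ν)
                               (Partition≤-removePart (suc (suc k)) ν ν-bounded)
                               (subst (2 ≤_) (sym (#ones-removePart (suc (suc k)) ν refl)) two≤ones)
                           | *-zeroʳ (suc k) = when-ε _

∑-downFrom⁺-≥ : ∀ n i (F : ℕ → ℕ) → 1 ≤ i → i ≤ n → F i ≤ ∑ (downFrom⁺ n) F
∑-downFrom⁺-≥ zero    (suc i) F 1≤i ()
∑-downFrom⁺-≥ (suc n) i F 1≤i i≤1+n with m≤n⇒m<n∨m≡n i≤1+n
... | inj₂ refl = m≤m+n (F (suc n)) _
... | inj₁ i<1+n = ≤-trans (∑-downFrom⁺-≥ n i F 1≤i (≤-pred i<1+n)) (m≤n+m _ (F (suc n)))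

pathExpansionF-coeff-positive : ∀ f M ν → M ≤ f → Partition≤ M ν → sumℕ ν ≡ M → #ones ν ≤ 1 → 0 < coeffℕ ν (pathExpansionF f M)
pathExpansionF-coeff-positive f       zero    []      _ _ _ _ = s≤s z≤n
pathExpansionF-coeff-positive f       zero    (p ∷ ν) _ (cons 1≤p _ _) ∑≡0 _ = ⊥-elim (<⇒≢ (≤-trans 1≤p (m≤m+n p (sumℕ ν))) (sym ∑≡0))
pathExpansionF-coeff-positive (suc f) (suc M) (1 ∷ []) _ ν-bounded refl _ =
  subst (0 <_) (sym (coeffℕ-pathExpansionF-suc f 0 (1 ∷ []) ν-bounded)) (s≤s z≤n)
pathExpansionF-coeff-positive (suc f) (suc M) (1 ∷ q ∷ ν) _ (cons _ _ (cons 1≤q q≤1 _)) _ ones≤1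
  with ≤-antisym q≤1 1≤q
... | refl = ⊥-elim (<⇒≱ (s≤s (s≤s z≤n)) (≤-trans (+-monoʳ-≤ 1 (m≤m+n 1 (#ones ν))) ones≤1))
pathExpansionF-coeff-positive (suc f) (suc M) (suc (suc k) ∷ ν) (s≤s M≤f) ν-bounded@(cons _ _ rest-bounded) ∑≡1+M ones≤1
  rewrite coeffℕ-pathExpansionF-suc f M (suc (suc k) ∷ ν) ν-bounded =
  ≤-trans first-part-term (≤-trans (∑-downFrom⁺-≥ (suc M) (suc (suc k)) term (s≤s z≤n) 2+k≤1+M)
                                   (m≤n+m _ (when ((suc M ∷ []) =ˡ (suc (suc k) ∷ ν)) 1)))
  where
  term : ℕ → ℕ
  term i = when (i ∈ᵇ (suc (suc k) ∷ ν)) ((i ∸ 1) * coeffℕ (removePart i (suc (suc k) ∷ ν)) (pathExpansionF f (suc M ∸ i)))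
  2+k≤1+M : suc (suc k) ≤ suc M
  2+k≤1+M = subst (suc (suc k) ≤_) ∑≡1+M (m≤m+n (suc (suc k)) (sumℕ ν))
  ∑ν : sumℕ ν ≡ M ∸ suc k
  ∑ν = trans (sym (m+n∸m≡n (suc (suc k)) (sumℕ ν))) (cong (_∸ suc (suc k)) ∑≡1+M)
  rest-positive : 0 < coeffℕ ν (pathExpansionF f (M ∸ suc k))
  rest-positive = pathExpansionF-coeff-positive f (M ∸ suc k) ν (≤-trans (m∸n≤m M (suc k)) M≤f)
    (subst (λ b → Partition≤ b ν) ∑ν (Partition≤-sum ν rest-bounded)) ∑ν ones≤1
    where
    Partition≤-sum : ∀ {b} ν → Partition≤ b ν → Partition≤ (sumℕ ν) ν
    Partition≤-sum []      []                   = []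
    Partition≤-sum (p ∷ ν) (cons 1≤p _ ν-bounded) = cons 1≤p (m≤m+n p (sumℕ ν)) ν-bounded
  first-part-term : 0 < term (suc (suc k))
  first-part-term rewrite ≡ᵇ-refl k = ≤-trans rest-positive (m≤m+n _ _)

pathCoeff : ℕ → List ℕ → ℕ
pathCoeff M ν = coeffℕ ν (pathExpansion M)

pathCoeff-suc : ∀ {b} M ν → Partition≤ b ν → pathCoeff (suc M) ν
  ≡ when ((suc M ∷ []) =ˡ ν) 1 + ∑ (downFrom⁺ (suc M)) (λ i → when (i ∈ᵇ ν) ((i ∸ 1) * pathCoeff (suc M ∸ i) (removePart i ν)))
pathCoeff-suc M ν ν-bounded =
  trans (coeffℕ-pathExpansionF-suc M M ν ν-bounded) (cong (_+_ (when ((suc M ∷ []) =ˡ ν) 1)) (∑-cong (downFrom⁺ (suc M)) unfuel))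
  where
  unfuel : ∀ i → when (i ∈ᵇ ν) ((i ∸ 1) * coeffℕ (removePart i ν) (pathExpansionF M (suc M ∸ i)))
                 ≡ when (i ∈ᵇ ν) ((i ∸ 1) * pathCoeff (suc M ∸ i) (removePart i ν))
  unfuel zero    = refl
  unfuel (suc i) = cong (λ L → when (suc i ∈ᵇ ν) (i * coeffℕ (removePart (suc i) ν) L)) (pathExpansionF-fuel M (M ∸ i) (m∸n≤m M i))

≡ᵇ-comm : ∀ m n → (m ≡ᵇ n) ≡ (n ≡ᵇ m)
≡ᵇ-comm m n = ⇔→≡ (mk⇔ (λ e → ≡⇒≡ᵇ-true n m (sym (≡ᵇ-true⇒≡ m n e)))
                        (λ e → ≡⇒≡ᵇ-true m n (sym (≡ᵇ-true⇒≡ n m e))))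

noRepeats : List ℕ → Bool
noRepeats []      = true
noRepeats (a ∷ ν) = not (a ∈ᵇ ν) ∧ noRepeats ν

∑-downFrom⁺-∈ᵇ : ∀ M ν (G : ℕ → ℕ) → noRepeats ν ≡ true → All (λ p → 1 ≤ p × p ≤ M) ν →
                 ∑ (downFrom⁺ M) (λ i → when (i ∈ᵇ ν) (G i)) ≡ ∑ ν G
∑-downFrom⁺-∈ᵇ M []      G _        []                 = ∑-ε (downFrom⁺ M)
∑-downFrom⁺-∈ᵇ M (a ∷ ν) G distinct ((1≤a , a≤M) ∷ ν-in-range) =
  trans (∑-cong (downFrom⁺ M) split) (trans (∑-distrib (downFrom⁺ M) _ _)
    (cong₂ _+_ δ-a (∑-downFrom⁺-∈ᵇ M ν G (∧-trueʳ {not (a ∈ᵇ ν)} distinct) ν-in-range)))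
  where
  split : ∀ i → when ((i ≡ᵇ a) ∨ (i ∈ᵇ ν)) (G i) ≡ when (i ≡ᵇ a) (G i) + when (i ∈ᵇ ν) (G i)
  split i with i ≡ᵇ a in i≟a
  ... | false = refl
  ... | true rewrite ≡ᵇ-true⇒≡ i a i≟a | not-injective {a ∈ᵇ ν} {false} (∧-trueˡ distinct) = sym (+-identityʳ (G a))
  δ-a : ∑ (downFrom⁺ M) (λ i → when (i ≡ᵇ a) (G i)) ≡ G a
  δ-a = trans (∑-cong (downFrom⁺ M) (λ i → cong (λ b → when b (G i)) (≡ᵇ-comm i a)))
    (trans (∑-downFrom⁺-δ M a G) (cong (λ b → when b (G a)) (∧-true (<⇒<ᵇ-true 0 a 1≤a) (<⇒<ᵇ-true a (suc M) (s≤s a≤M)))))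

-- Here `parts` lists the distinct parts of ν = a ∷ b ∷ ρ.
pathCoeff-by-parts : ∀ M a b ρ parts → Partition≤ (suc M) (a ∷ b ∷ ρ) → (∀ i → (i ∈ᵇ (a ∷ b ∷ ρ)) ≡ (i ∈ᵇ parts)) →
  noRepeats parts ≡ true → All (λ p → 1 ≤ p × p ≤ suc M) parts →
  pathCoeff (suc M) (a ∷ b ∷ ρ) ≡ ∑ parts (λ i → (i ∸ 1) * pathCoeff (suc M ∸ i) (removePart i (a ∷ b ∷ ρ)))
pathCoeff-by-parts M a b ρ parts ν-bounded same-parts distinct in-range =
  trans (pathCoeff-suc M (a ∷ b ∷ ρ) ν-bounded)
    (cong₂ _+_ (cong (λ c → when c 1) (dec-false ((suc M ∷ []) ≟ₗ (a ∷ b ∷ ρ)) (λ ())))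
      (trans (∑-cong (downFrom⁺ (suc M)) (λ i → cong (λ c → when c _) (same-parts i))) (∑-downFrom⁺-∈ᵇ (suc M) parts _ distinct in-range)))

pathCoeff-single : ∀ k → 1 ≤ k → pathCoeff k (k ∷ []) ≡ k
pathCoeff-single (suc k) _ = begin
  pathCoeff (suc k) (suc k ∷ [])
    ≡⟨ pathCoeff-suc k (suc k ∷ []) (cons (s≤s z≤n) ≤-refl []) ⟩
  when ((suc k ∷ []) =ˡ (suc k ∷ [])) 1 + ∑ (downFrom⁺ (suc k)) (λ i → when (i ∈ᵇ (suc k ∷ [])) (term i))
    ≡⟨ cong₂ _+_ (cong (λ c → when c 1) (=ˡ-refl (suc k ∷ [])))
                 (∑-downFrom⁺-∈ᵇ (suc k) (suc k ∷ []) term refl ((s≤s z≤n , ≤-refl) ∷ [])) ⟩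
  1 + (term (suc k) + 0)
    ≡⟨ cong suc (trans (+-identityʳ _) (cong (λ ν → k * pathCoeff (k ∸ k) ν) (removePart-head k))) ⟩
  1 + k * pathCoeff (k ∸ k) []
    ≡⟨ cong (λ m → 1 + k * pathCoeff m []) (n∸n≡0 k) ⟩
  1 + k * 1
    ≡⟨ cong suc (*-identityʳ k) ⟩
  suc k ∎
  where
  open ≡-Reasoning
  term : ℕ → ℕ
  term i = (i ∸ 1) * pathCoeff (suc k ∸ i) (removePart i (suc k ∷ []))
  removePart-head : ∀ k → removePart (suc k) (suc k ∷ []) ≡ []
  removePart-head k rewrite ≡ᵇ-refl k = refl

pathCoeff-[a,2] : ∀ a → 3 ≤ a → pathCoeff (2 + a) (a ∷ 2 ∷ []) ≡ (a ∸ 1) * 2 + a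
pathCoeff-[a,2] a 3≤a = begin
  pathCoeff (2 + a) (a ∷ 2 ∷ [])
    ≡⟨ pathCoeff-by-parts (suc a) a 2 [] (a ∷ 2 ∷ []) (cons 1≤a (≤-trans (n≤1+n a) (n≤1+n (suc a))) (cons (s≤s z≤n) 2≤a []))
                          (λ i → refl) distinct ((1≤a , ≤-trans (n≤1+n a) (n≤1+n (suc a))) ∷ (s≤s z≤n , s≤s (s≤s z≤n)) ∷ []) ⟩
  (a ∸ 1) * pathCoeff (2 + a ∸ a) (removePart a (a ∷ 2 ∷ [])) + (1 * pathCoeff a (removePart 2 (a ∷ 2 ∷ [])) + 0)
    ≡⟨ cong₂ (λ m ν → (a ∸ 1) * pathCoeff m ν + (1 * pathCoeff a (removePart 2 (a ∷ 2 ∷ [])) + 0)) (m+n∸n≡m 2 a) removePart-a ⟩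
  (a ∸ 1) * pathCoeff 2 (2 ∷ []) + (1 * pathCoeff a (removePart 2 (a ∷ 2 ∷ [])) + 0)
    ≡⟨ cong (λ ν → (a ∸ 1) * 2 + (1 * pathCoeff a ν + 0)) removePart-2 ⟩
  (a ∸ 1) * 2 + (1 * pathCoeff a (a ∷ []) + 0)
    ≡⟨ cong (λ m → (a ∸ 1) * 2 + (1 * m + 0)) (pathCoeff-single a 1≤a) ⟩
  (a ∸ 1) * 2 + (1 * a + 0)
    ≡⟨ cong (_+_ ((a ∸ 1) * 2)) (trans (+-identityʳ _) (*-identityˡ a)) ⟩
  (a ∸ 1) * 2 + a ∎
  where
  open ≡-Reasoning
  1≤a : 1 ≤ a
  1≤a = ≤-trans (s≤s z≤n) 3≤a
  2≤a : 2 ≤ a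
  2≤a = ≤-trans (s≤s (s≤s z≤n)) 3≤a
  a≢2 : (a ≡ᵇ 2) ≡ false
  a≢2 = ≢⇒≡ᵇ-false a 2 (λ a≡2 → <⇒≢ 3≤a (sym a≡2))
  distinct : noRepeats (a ∷ 2 ∷ []) ≡ true
  distinct rewrite a≢2 = refl
  removePart-a : removePart a (a ∷ 2 ∷ []) ≡ 2 ∷ []
  removePart-a rewrite ≡ᵇ-refl a = refl
  removePart-2 : removePart 2 (a ∷ 2 ∷ []) ≡ a ∷ []
  removePart-2 rewrite ≡ᵇ-comm 2 a | a≢2 = refl

pathCoeff-[n,2,1] : ∀ n → 3 ≤ n → pathCoeff (3 + n) (n ∷ 2 ∷ 1 ∷ []) ≡ (n ∸ 1) + pathCoeff (suc n) (n ∷ 1 ∷ [])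
pathCoeff-[n,2,1] n 3≤n = begin
  pathCoeff (3 + n) (n ∷ 2 ∷ 1 ∷ [])
    ≡⟨ pathCoeff-by-parts (2 + n) n 2 (1 ∷ []) (n ∷ 2 ∷ 1 ∷ []) (cons 1≤n (m≤n+m n 3) (cons (s≤s z≤n) 2≤n (cons ≤-refl (s≤s z≤n) [])))
                          (λ i → refl) distinct ((1≤n , m≤n+m n 3) ∷ (s≤s z≤n , s≤s (s≤s z≤n)) ∷ (≤-refl , s≤s z≤n) ∷ []) ⟩
  (n ∸ 1) * pathCoeff (3 + n ∸ n) (removePart n (n ∷ 2 ∷ 1 ∷ [])) + (1 * pathCoeff (suc n) (removePart 2 (n ∷ 2 ∷ 1 ∷ [])) + (0 + 0))
    ≡⟨ cong₂ (λ m ν → (n ∸ 1) * pathCoeff m ν + (1 * pathCoeff (suc n) (removePart 2 (n ∷ 2 ∷ 1 ∷ [])) + 0)) (m+n∸n≡m 3 n) removePart-n ⟩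
  (n ∸ 1) * pathCoeff 3 (2 ∷ 1 ∷ []) + (1 * pathCoeff (suc n) (removePart 2 (n ∷ 2 ∷ 1 ∷ [])) + 0)
    ≡⟨ cong (λ ν → (n ∸ 1) * 1 + (1 * pathCoeff (suc n) ν + 0)) removePart-2 ⟩
  (n ∸ 1) * 1 + (1 * pathCoeff (suc n) (n ∷ 1 ∷ []) + 0)
    ≡⟨ cong₂ _+_ (*-identityʳ (n ∸ 1)) (trans (+-identityʳ _) (*-identityˡ _)) ⟩
  (n ∸ 1) + pathCoeff (suc n) (n ∷ 1 ∷ []) ∎
  where
  open ≡-Reasoning
  1≤n : 1 ≤ n
  1≤n = ≤-trans (s≤s z≤n) 3≤n
  2≤n : 2 ≤ n
  2≤n = ≤-trans (s≤s (s≤s z≤n)) 3≤n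
  n≢2 : (n ≡ᵇ 2) ≡ false
  n≢2 = ≢⇒≡ᵇ-false n 2 (λ n≡2 → <⇒≢ 3≤n (sym n≡2))
  n≢1 : (n ≡ᵇ 1) ≡ false
  n≢1 = ≢⇒≡ᵇ-false n 1 (λ n≡1 → <⇒≢ 2≤n (sym n≡1))
  distinct : noRepeats (n ∷ 2 ∷ 1 ∷ []) ≡ true
  distinct rewrite n≢2 | n≢1 = refl
  removePart-n : removePart n (n ∷ 2 ∷ 1 ∷ []) ≡ 2 ∷ 1 ∷ []
  removePart-n rewrite ≡ᵇ-refl n = refl
  removePart-2 : removePart 2 (n ∷ 2 ∷ 1 ∷ []) ≡ n ∷ 1 ∷ []
  removePart-2 rewrite ≡ᵇ-comm 2 n | n≢2 = refl

pathCoeff-[a,2,2] : ∀ a → 3 ≤ a → pathCoeff (4 + a) (a ∷ 2 ∷ 2 ∷ []) ≡ (a ∸ 1) * 2 + pathCoeff (2 + a) (a ∷ 2 ∷ [])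
pathCoeff-[a,2,2] a 3≤a = begin
  pathCoeff (4 + a) (a ∷ 2 ∷ 2 ∷ [])
    ≡⟨ pathCoeff-by-parts (3 + a) a 2 (2 ∷ []) (a ∷ 2 ∷ []) (cons 1≤a (m≤n+m a 4) (cons (s≤s z≤n) 2≤a (cons (s≤s z≤n) ≤-refl [])))
                          same-parts distinct ((1≤a , m≤n+m a 4) ∷ (s≤s z≤n , s≤s (s≤s z≤n)) ∷ []) ⟩
  (a ∸ 1) * pathCoeff (4 + a ∸ a) (removePart a (a ∷ 2 ∷ 2 ∷ [])) + (1 * pathCoeff (2 + a) (removePart 2 (a ∷ 2 ∷ 2 ∷ [])) + 0)
    ≡⟨ cong₂ (λ m ν → (a ∸ 1) * pathCoeff m ν + (1 * pathCoeff (2 + a) (removePart 2 (a ∷ 2 ∷ 2 ∷ [])) + 0)) (m+n∸n≡m 4 a) removePart-a ⟩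
  (a ∸ 1) * pathCoeff 4 (2 ∷ 2 ∷ []) + (1 * pathCoeff (2 + a) (removePart 2 (a ∷ 2 ∷ 2 ∷ [])) + 0)
    ≡⟨ cong (λ ν → (a ∸ 1) * 2 + (1 * pathCoeff (2 + a) ν + 0)) removePart-2 ⟩
  (a ∸ 1) * 2 + (1 * pathCoeff (2 + a) (a ∷ 2 ∷ []) + 0)
    ≡⟨ cong (_+_ ((a ∸ 1) * 2)) (trans (+-identityʳ _) (*-identityˡ _)) ⟩
  (a ∸ 1) * 2 + pathCoeff (2 + a) (a ∷ 2 ∷ []) ∎
  where
  open ≡-Reasoning
  1≤a : 1 ≤ a
  1≤a = ≤-trans (s≤s z≤n) 3≤a
  2≤a : 2 ≤ a
  2≤a = ≤-trans (s≤s (s≤s z≤n)) 3≤a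
  a≢2 : (a ≡ᵇ 2) ≡ false
  a≢2 = ≢⇒≡ᵇ-false a 2 (λ a≡2 → <⇒≢ 3≤a (sym a≡2))
  distinct : noRepeats (a ∷ 2 ∷ []) ≡ true
  distinct rewrite a≢2 = refl
  same-parts : ∀ i → (i ∈ᵇ (a ∷ 2 ∷ 2 ∷ [])) ≡ (i ∈ᵇ (a ∷ 2 ∷ []))
  same-parts i with i ≡ᵇ 2
  ... | true  = refl
  ... | false = refl
  removePart-a : removePart a (a ∷ 2 ∷ 2 ∷ []) ≡ 2 ∷ 2 ∷ []
  removePart-a rewrite ≡ᵇ-refl a = refl
  removePart-2 : removePart 2 (a ∷ 2 ∷ 2 ∷ []) ≡ a ∷ 2 ∷ []
  removePart-2 rewrite ≡ᵇ-comm 2 a | a≢2 = refl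

-- The e-expansions of X_{P_N} and X_L

toℤ : Combination ℕ → Combination ℤ
toℤ = map (λ (c , μ) → (+ c , μ))

negate : Combination ℤ → Combination ℤ
negate = map (λ (c , μ) → (- c , μ))

scale : ℕ → Combination ℕ → Combination ℕ
scale k = map (λ (c , μ) → (k * c , μ))

evalℤ-toℤ : ∀ {K} L (α : Fin K → ℕ) → evalℤ (toℤ L) α ≡ + evalℕ L α
evalℤ-toℤ L α = trans (∑ℤ.∑-map L _ _) (trans (∑ℤ.∑-cong L (λ (c , μ) → sym (ℤ.pos-* c _))) (pos-∑ L _))

coeffℤ-toℤ : ∀ ν L → coeffℤ ν (toℤ L) ≡ + coeffℕ ν L
coeffℤ-toℤ ν L = trans (∑ℤ.∑-map L _ _) (trans (∑ℤ.∑-cong L (λ (c , μ) → pos-when (μ =ˡ ν) c)) (pos-∑ L _))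
  where
  pos-when : ∀ b c → ∑ℤ.when b (+ c) ≡ + when b c
  pos-when true  c = refl
  pos-when false c = refl

evalℤ-negate : ∀ {K} L (α : Fin K → ℕ) → evalℤ (negate L) α ≡ - evalℤ L α
evalℤ-negate L α = trans (∑ℤ.∑-map L _ _) (trans (∑ℤ.∑-cong L (λ (c , μ) → sym (ℤ.neg-distribˡ-* c _))) (neg-distrib-∑ L _))

coeffℤ-negate : ∀ ν L → coeffℤ ν (negate L) ≡ - coeffℤ ν L
coeffℤ-negate ν L = trans (∑ℤ.∑-map L _ _) (trans (∑ℤ.∑-cong L (λ (c , μ) → neg-when (μ =ˡ ν) c)) (neg-distrib-∑ L _))
  where
  neg-when : ∀ b c → ∑ℤ.when b (- c) ≡ - ∑ℤ.when b c
  neg-when true  c = refl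
  neg-when false c = refl

evalℕ-scale : ∀ {K} k L (α : Fin K → ℕ) → evalℕ (scale k L) α ≡ k * evalℕ L α
evalℕ-scale k L α = trans (∑-map L _ _) (trans (∑-cong L (λ (c , μ) → *-assoc k c _)) (*-distribˡ-∑ L k _))

coeffℕ-scale : ∀ k ν L → coeffℕ ν (scale k L) ≡ k * coeffℕ ν L
coeffℕ-scale k ν L = trans (∑-map L _ _) (trans (∑-cong L (λ (c , μ) → sym (*-when k (μ =ˡ ν) c))) (*-distribˡ-∑ L k _))

module _ {K : ℕ} where

  coeffℤ-unique : ∀ L₁ L₂ → All (Partition≤ K ∘ proj₂) L₁ → All (Partition≤ K ∘ proj₂) L₂ →
                  (∀ α → evalℤ {K} L₁ α ≡ evalℤ L₂ α) → ∀ ν → coeffℤ ν L₁ ≡ coeffℤ ν L₂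
  coeffℤ-unique L₁ L₂ L₁-bounded L₂-bounded L₁≡L₂ ν = ℤ.i-j≡0⇒i≡j _ _ (begin
    coeffℤ ν L₁ +ℤ - coeffℤ ν L₂          ≡⟨ cong (coeffℤ ν L₁ +ℤ_) (coeffℤ-negate ν L₂) ⟨
    coeffℤ ν L₁ +ℤ coeffℤ ν (negate L₂)   ≡⟨ ∑ℤ.∑-++ L₁ (negate L₂) _ ⟨
    coeffℤ ν (L₁ ++ negate L₂)            ≡⟨ coeffℤ-vanishes (length (L₁ ++ negate L₂)) (L₁ ++ negate L₂) ≤-refl
                                               (All.++⁺ L₁-bounded (All.map⁺ (All.map id L₂-bounded))) difference≡0 ν ⟩
    + 0                                   ∎)
    where
    open ≡-Reasoning
    difference≡0 : ∀ α → evalℤ (L₁ ++ negate L₂) α ≡ + 0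
    difference≡0 α = begin
      evalℤ (L₁ ++ negate L₂) α              ≡⟨ ∑ℤ.∑-++ L₁ (negate L₂) _ ⟩
      evalℤ L₁ α +ℤ evalℤ (negate L₂) α      ≡⟨ cong₂ _+ℤ_ (L₁≡L₂ α) (evalℤ-negate L₂ α) ⟩
      evalℤ L₂ α +ℤ - evalℤ L₂ α             ≡⟨ ℤ.+-inverseʳ (evalℤ L₂ α) ⟩
      + 0                                    ∎

expansionOf : ℕ → (List ℕ → ℤ) → Combination ℤ
expansionOf N c = map (λ μ → (c μ , μ)) (partitions N)

coeffℤ-expansionOf : ∀ N c ν → IsPartitionOf N ν → coeffℤ ν (expansionOf N c) ≡ c ν
coeffℤ-expansionOf N c ν ν⊢N = begin
  coeffℤ ν (expansionOf N c)                        ≡⟨ ∑ℤ.∑-map (partitions N) _ _ ⟩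
  ∑ℤ.∑ (partitions N) (λ μ → ∑ℤ.when (μ =ˡ ν) (c μ)) ≡⟨ count (partitions N) ⟩
  + occurrences ν (partitions N) *ℤ c ν             ≡⟨ cong (λ k → + k *ℤ c ν) occurs-once ⟩
  + 1 *ℤ c ν                                        ≡⟨ ℤ.*-identityˡ (c ν) ⟩
  c ν                                               ∎
  where
  open ≡-Reasoning
  occurs-once : occurrences ν (partitions N) ≡ 1
  occurs-once = occurrences-partsB N N N ν ≤-refl (IsPartitionOf⇒Partition≤ N ν ν⊢N) (proj₁ ν⊢N)
  count : ∀ L → ∑ℤ.∑ L (λ μ → ∑ℤ.when (μ =ˡ ν) (c μ)) ≡ + occurrences ν L *ℤ c ν
  count []      = refl
  count (μ ∷ L) with μ ≟ₗ ν
  ... | yes refl rewrite count L = trans (cong (_+ℤ (+ occurrences μ L *ℤ c μ)) (sym (ℤ.*-identityˡ (c μ))))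
    (trans (sym (ℤ.*-distribʳ-+ (c μ) (+ 1) (+ occurrences μ L))) (cong (_*ℤ c μ) (sym (ℤ.pos-+ 1 (occurrences μ L)))))
  ... | no _     rewrite count L = ℤ.+-identityˡ _

eExpansion-coeff : ∀ {N} (G : Graph N) c L → IsEExpansion G c → All (Partition≤ N ∘ proj₂) L →
                   (∀ α → + XCoeff G α ≡ evalℤ L α) → ∀ ν → IsPartitionOf N ν → c ν ≡ coeffℤ ν L
eExpansion-coeff {N} G c L c-expands L-bounded L-evaluates ν ν⊢N =
  trans (sym (coeffℤ-expansionOf N c ν ν⊢N))
        (coeffℤ-unique (expansionOf N c) L (All.map⁺ (partsB-bounded N N N)) L-bounded
                       (λ α → trans (∑ℤ.∑-map (partitions N) _ _) (trans (sym (c-expands α)) (L-evaluates α))) ν)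

pathGraph-eCoeff : ∀ N d → IsEExpansion (pathGraph N) d → ∀ ν → IsPartitionOf N ν → d ν ≡ + pathCoeff N ν
pathGraph-eCoeff N d d-expands ν ν⊢N =
  trans (eExpansion-coeff (pathGraph N) d (toℤ (pathExpansion N)) d-expands (All.map⁺ (pathExpansionF-bounded N N))
          (λ α → trans (cong +_ (XCoeff-path N α))
                       (sym (trans (evalℤ-toℤ (pathExpansion N) α) (cong +_ (evalℕ-pathExpansionF N N ≤-refl α))))) ν ν⊢N)
        (coeffℤ-toℤ ν (pathExpansion N))

module _ (n : ℕ) where

  twice-path : Combination ℤ
  twice-path = toℤ (scale 2 (pathExpansion (3 + n)))

  e₂-path : Combination ℕ
  e₂-path = scaleInsert 2 2 (pathExpansion (suc n))

  minus-e₂-path : Combination ℤ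
  minus-e₂-path = negate (toℤ e₂-path)

  lariatExpansion : Combination ℤ
  lariatExpansion = twice-path ++ minus-e₂-path

pos-+-neg : ∀ x y → + (x + y) +ℤ - + y ≡ + x
pos-+-neg x y = begin
  + (x + y) +ℤ - + y       ≡⟨ cong (_+ℤ - + y) (ℤ.pos-+ x y) ⟩
  + x +ℤ + y +ℤ - + y      ≡⟨ ℤ.+-assoc (+ x) (+ y) (- + y) ⟩
  + x +ℤ (+ y +ℤ - + y)    ≡⟨ cong (+ x +ℤ_) (ℤ.+-inverseʳ (+ y)) ⟩
  + x +ℤ + 0               ≡⟨ ℤ.+-identityʳ (+ x) ⟩
  + x                      ∎
  where open ≡-Reasoning

difference-of-doubles : ∀ A B X → 2 * A ≡ X + 2 * B → + (2 * A) +ℤ - + (2 * B) ≡ + X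
difference-of-doubles A B X 2A≡X+2B = trans (cong (λ x → + x +ℤ - + (2 * B)) 2A≡X+2B) (pos-+-neg X (2 * B))

evalℤ-lariatExpansion : ∀ n (α : Fin (3 + n) → ℕ) → + XCoeff (lariat n) α ≡ evalℤ (lariatExpansion n) α
evalℤ-lariatExpansion n α = sym (begin
  evalℤ (lariatExpansion n) α
    ≡⟨ ∑ℤ.∑-++ (twice-path n) (minus-e₂-path n) (λ (c , μ) → c *ℤ + eCoeff μ α) ⟩
  evalℤ (toℤ (scale 2 (pathExpansion (3 + n)))) α +ℤ evalℤ (negate (toℤ (scaleInsert 2 2 (pathExpansion (suc n))))) α
    ≡⟨ cong₂ _+ℤ_ (trans (evalℤ-toℤ (scale 2 (pathExpansion (3 + n))) α) (cong +_ (evalℕ-scale 2 (pathExpansion (3 + n)) α)))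
                  (trans (evalℤ-negate (toℤ (e₂-path n)) α) (cong -_ (evalℤ-toℤ (e₂-path n) α))) ⟩
  + (2 * evalℕ (pathExpansion (3 + n)) α) +ℤ - + evalℕ (scaleInsert 2 2 (pathExpansion (suc n))) α
    ≡⟨ cong₂ (λ x y → + (2 * x) +ℤ - + y) (evalℕ-pathExpansionF (3 + n) (3 + n) ≤-refl α) e₂-part ⟩
  + (2 * smirnov (3 + n) α nothing) +ℤ - + (2 * e₂Term n α)
    ≡⟨ cong (λ x → + x +ℤ - + (2 * e₂Term n α)) (lariat-identity n α) ⟨
  + (lariatCount n α + 2 * e₂Term n α) +ℤ - + (2 * e₂Term n α)
    ≡⟨ pos-+-neg (lariatCount n α) (2 * e₂Term n α) ⟩
  + lariatCount n α
    ≡⟨ cong +_ (XCoeff-lariat n α) ⟨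
  + XCoeff (lariat n) α ∎)
  where
  open ≡-Reasoning
  e₂-part : evalℕ (scaleInsert 2 2 (pathExpansion (suc n))) α ≡ 2 * e₂Term n α
  e₂-part = trans (evalℕ-scaleInsert 2 2 (pathExpansion (suc n)) α) (cong (2 *_) (∑-cong (subsets (3 + n)) (λ S →
    cong (when _) (evalℕ-pathExpansionF (suc n) (suc n) ≤-refl (α ∸ˢ S)))))

lariatExpansion-bounded : ∀ n → All (Partition≤ (3 + n) ∘ proj₂) (lariatExpansion n)
lariatExpansion-bounded n = All.++⁺ (All.map⁺ (All.map⁺ (pathExpansionF-bounded (3 + n) (3 + n))))
  (All.map⁺ (All.map⁺ (All.map⁺ (All.map insert-2 (pathExpansionF-bounded (suc n) (suc n))))))
  where
  insert-2 : ∀ {μ} → Partition≤ (suc n) μ → Partition≤ (3 + n) (insertPart 2 μ)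
  insert-2 μ-bounded = Partition≤-insertPart 2 _ (Partition≤-weaken (m≤n+m (suc n) 2) μ-bounded) (s≤s z≤n) (s≤s (s≤s z≤n))

lariat-eCoeff : ∀ n c → IsEExpansion (lariat n) c → ∀ ν → IsPartitionOf (3 + n) ν →
  c ν ≡ + (2 * pathCoeff (3 + n) ν) +ℤ - + when (2 ∈ᵇ ν) (2 * pathCoeff (suc n) (removePart 2 ν))
lariat-eCoeff n c c-expands ν ν⊢N = begin
  c ν
    ≡⟨ eExpansion-coeff (lariat n) c (lariatExpansion n) c-expands (lariatExpansion-bounded n) (evalℤ-lariatExpansion n) ν ν⊢N ⟩
  coeffℤ ν (lariatExpansion n)
    ≡⟨ ∑ℤ.∑-++ (twice-path n) (minus-e₂-path n) (λ (c , μ) → ∑ℤ.when (μ =ˡ ν) c) ⟩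
  coeffℤ ν (toℤ (scale 2 (pathExpansion (3 + n)))) +ℤ coeffℤ ν (negate (toℤ (scaleInsert 2 2 (pathExpansion (suc n)))))
    ≡⟨ cong₂ _+ℤ_ (trans (coeffℤ-toℤ ν (scale 2 (pathExpansion (3 + n)))) (cong +_ (coeffℕ-scale 2 ν (pathExpansion (3 + n)))))
                  (trans (coeffℤ-negate ν (toℤ (e₂-path n))) (cong -_ (trans (coeffℤ-toℤ ν (e₂-path n))
                    (cong +_ (coeffℕ-scaleInsert 2 2 (pathExpansion (suc n)) ν (IsPartitionOf⇒Partition≤ (3 + n) ν ν⊢N)))))) ⟩
  + (2 * pathCoeff (3 + n) ν) +ℤ - + when (2 ∈ᵇ ν) (2 * pathCoeff (suc n) (removePart 2 ν)) ∎
  where open ≡-Reasoning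

module _ (n : ℕ) (c : List ℕ → ℤ) (c-expands : IsEExpansion (lariat n) c) where

  lariat-eCoeff-without-2 : ∀ ν → IsPartitionOf (3 + n) ν → 2 ∉ ν → c ν ≡ + (2 * pathCoeff (3 + n) ν)
  lariat-eCoeff-without-2 ν ν⊢N 2∉ν =
    trans (lariat-eCoeff n c c-expands ν ν⊢N)
          (trans (cong (λ b → + (2 * pathCoeff (3 + n) ν) +ℤ - + when b (2 * pathCoeff (suc n) (removePart 2 ν))) (∉⇒∈ᵇ-false 2 ν 2∉ν))
                 (ℤ.+-identityʳ (+ (2 * pathCoeff (3 + n) ν))))

  lariat-eCoeff-with-2 : ∀ ν → IsPartitionOf (3 + n) ν → (2 ∈ᵇ ν) ≡ true →
    c ν ≡ + (2 * pathCoeff (3 + n) ν) +ℤ - + (2 * pathCoeff (suc n) (removePart 2 ν))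
  lariat-eCoeff-with-2 ν ν⊢N 2∈ν =
    trans (lariat-eCoeff n c c-expands ν ν⊢N)
          (cong (λ b → + (2 * pathCoeff (3 + n) ν) +ℤ - + when b (2 * pathCoeff (suc n) (removePart 2 ν))) 2∈ν)

lariat-support⊆path-support : ∀ n c d → IsEExpansion (lariat n) c → IsEExpansion (pathGraph (3 + n)) d →
                              ∀ ν → IsPartitionOf (3 + n) ν → c ν ≢ + 0 → d ν ≢ + 0
lariat-support⊆path-support n c d c-expands d-expands ν ν⊢N c≢0 d≡0 = c≢0 (begin
  c ν
    ≡⟨ lariat-eCoeff n c c-expands ν ν⊢N ⟩
  + (2 * pathCoeff (3 + n) ν) +ℤ - + when (2 ∈ᵇ ν) (2 * pathCoeff (suc n) (removePart 2 ν))
    ≡⟨ cong₂ (λ x y → + (2 * x) +ℤ - + when (2 ∈ᵇ ν) (2 * y)) path≡0 removed≡0 ⟩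
  + 0 +ℤ - + when (2 ∈ᵇ ν) 0
    ≡⟨ cong (λ x → + 0 +ℤ - + x) (when-ε (2 ∈ᵇ ν)) ⟩
  + 0 ∎)
  where
  open ≡-Reasoning
  ν-bounded : Partition≤ (3 + n) ν
  ν-bounded = IsPartitionOf⇒Partition≤ (3 + n) ν ν⊢N
  path≡0 : pathCoeff (3 + n) ν ≡ 0
  path≡0 = ℤ.+-injective (trans (sym (pathGraph-eCoeff (3 + n) d d-expands ν ν⊢N)) d≡0)
  two-ones : 2 ≤ #ones ν
  two-ones with #ones ν ≤? 1
  ... | yes ones≤1 = ⊥-elim (<⇒≢ (pathExpansionF-coeff-positive (3 + n) (3 + n) ν ≤-refl ν-bounded (proj₁ ν⊢N) ones≤1) (sym path≡0))
  ... | no  ones≰1 = ≰⇒> ones≰1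
  removed≡0 : pathCoeff (suc n) (removePart 2 ν) ≡ 0
  removed≡0 = pathExpansionF-coeff-vanishes (suc n) (suc n) (removePart 2 ν) (Partition≤-removePart 2 ν ν-bounded)
                (subst (2 ≤_) (sym (#ones-removePart 2 ν refl)) two-ones)

lariat-eCoeff-no-2 : ∀ n c d → IsEExpansion (lariat n) c → IsEExpansion (pathGraph (3 + n)) d →
                     ∀ ν → IsPartitionOf (3 + n) ν → 2 ∉ ν → c ν ≡ + 2 *ℤ d ν
lariat-eCoeff-no-2 n c d c-expands d-expands ν ν⊢N 2∉ν =
  trans (lariat-eCoeff-without-2 n c c-expands ν ν⊢N 2∉ν)
        (trans (ℤ.pos-* 2 (pathCoeff (3 + n) ν)) (cong (+ 2 *ℤ_) (sym (pathGraph-eCoeff (3 + n) d d-expands ν ν⊢N))))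

lariat-eCoeff-[n+1,2] : ∀ n c → IsEExpansion (lariat n) c → 2 ≤ n → c (suc n ∷ 2 ∷ []) ≡ + (4 * n)
lariat-eCoeff-[n+1,2] n c c-expands 2≤n = begin
  c (suc n ∷ 2 ∷ [])
    ≡⟨ lariat-eCoeff-with-2 n c c-expands (suc n ∷ 2 ∷ []) ν⊢N (∨-zeroʳ (2 ≡ᵇ suc n)) ⟩
  + (2 * pathCoeff (3 + n) (suc n ∷ 2 ∷ [])) +ℤ - + (2 * pathCoeff (suc n) (removePart 2 (suc n ∷ 2 ∷ [])))
    ≡⟨ cong₂ (λ x ν → + (2 * x) +ℤ - + (2 * pathCoeff (suc n) ν)) (pathCoeff-[a,2] (suc n) (s≤s 2≤n)) removePart-2 ⟩
  + (2 * (n * 2 + suc n)) +ℤ - + (2 * pathCoeff (suc n) (suc n ∷ []))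
    ≡⟨ cong (λ x → + (2 * (n * 2 + suc n)) +ℤ - + (2 * x)) (pathCoeff-single (suc n) (s≤s z≤n)) ⟩
  + (2 * (n * 2 + suc n)) +ℤ - + (2 * suc n)
    ≡⟨ difference-of-doubles (n * 2 + suc n) (suc n) (4 * n)
         (solve 1 (λ n → con 2 :* (n :* con 2 :+ (con 1 :+ n)) := con 4 :* n :+ con 2 :* (con 1 :+ n)) refl n) ⟩
  + (4 * n) ∎
  where
  open ≡-Reasoning
  open +-*-Solver
  ν⊢N : IsPartitionOf (3 + n) (suc n ∷ 2 ∷ [])
  ν⊢N = +-comm (suc n) 2 , s≤s z≤n ∷ s≤s z≤n ∷ [] , ≤-trans 2≤n (n≤1+n n) ∷ [-]
  removePart-2 : removePart 2 (suc n ∷ 2 ∷ []) ≡ suc n ∷ []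
  removePart-2 rewrite ≢⇒≡ᵇ-false 2 (suc n) (<⇒≢ (s≤s 2≤n)) = refl

lariat-eCoeff-[n,2,1] : ∀ n c → IsEExpansion (lariat n) c → 3 ≤ n → c (n ∷ 2 ∷ 1 ∷ []) ≡ + (2 * (n ∸ 1))
lariat-eCoeff-[n,2,1] n c c-expands 3≤n = begin
  c (n ∷ 2 ∷ 1 ∷ [])
    ≡⟨ lariat-eCoeff-with-2 n c c-expands (n ∷ 2 ∷ 1 ∷ []) ν⊢N (∨-zeroʳ (2 ≡ᵇ n)) ⟩
  + (2 * pathCoeff (3 + n) (n ∷ 2 ∷ 1 ∷ [])) +ℤ - + (2 * pathCoeff (suc n) (removePart 2 (n ∷ 2 ∷ 1 ∷ [])))
    ≡⟨ cong₂ (λ x ν → + (2 * x) +ℤ - + (2 * pathCoeff (suc n) ν)) (pathCoeff-[n,2,1] n 3≤n) removePart-2 ⟩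
  + (2 * ((n ∸ 1) + pathCoeff (suc n) (n ∷ 1 ∷ []))) +ℤ - + (2 * pathCoeff (suc n) (n ∷ 1 ∷ []))
    ≡⟨ difference-of-doubles ((n ∸ 1) + D) D (2 * (n ∸ 1)) (*-distribˡ-+ 2 (n ∸ 1) D) ⟩
  + (2 * (n ∸ 1)) ∎
  where
  open ≡-Reasoning
  D : ℕ
  D = pathCoeff (suc n) (n ∷ 1 ∷ [])
  2≤n : 2 ≤ n
  2≤n = ≤-trans (n≤1+n 2) 3≤n
  ν⊢N : IsPartitionOf (3 + n) (n ∷ 2 ∷ 1 ∷ [])
  ν⊢N = +-comm n 3 , ≤-trans (s≤s z≤n) 3≤n ∷ s≤s z≤n ∷ s≤s z≤n ∷ [] , 2≤n ∷ s≤s z≤n ∷ [-]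
  removePart-2 : removePart 2 (n ∷ 2 ∷ 1 ∷ []) ≡ n ∷ 1 ∷ []
  removePart-2 rewrite ≢⇒≡ᵇ-false 2 n (<⇒≢ 3≤n) = refl

lariat-eCoeff-[n-1,2,2] : ∀ n c → IsEExpansion (lariat n) c → 4 ≤ n → c (n ∸ 1 ∷ 2 ∷ 2 ∷ []) ≡ + (4 * (n ∸ 2))
lariat-eCoeff-[n-1,2,2] (suc a) c c-expands (s≤s 3≤a) = begin
  c (a ∷ 2 ∷ 2 ∷ [])
    ≡⟨ lariat-eCoeff-with-2 (suc a) c c-expands (a ∷ 2 ∷ 2 ∷ []) ν⊢N (∨-zeroʳ (2 ≡ᵇ a)) ⟩
  + (2 * pathCoeff (4 + a) (a ∷ 2 ∷ 2 ∷ [])) +ℤ - + (2 * pathCoeff (2 + a) (removePart 2 (a ∷ 2 ∷ 2 ∷ [])))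
    ≡⟨ cong₂ (λ x ν → + (2 * x) +ℤ - + (2 * pathCoeff (2 + a) ν)) (pathCoeff-[a,2,2] a 3≤a) removePart-2 ⟩
  + (2 * ((a ∸ 1) * 2 + pathCoeff (2 + a) (a ∷ 2 ∷ []))) +ℤ - + (2 * pathCoeff (2 + a) (a ∷ 2 ∷ []))
    ≡⟨ difference-of-doubles ((a ∸ 1) * 2 + D) D (4 * (a ∸ 1))
         (solve 2 (λ x D → con 2 :* (x :* con 2 :+ D) := con 4 :* x :+ con 2 :* D) refl (a ∸ 1) D) ⟩
  + (4 * (a ∸ 1)) ∎
  where
  open ≡-Reasoning
  open +-*-Solver
  D : ℕ
  D = pathCoeff (2 + a) (a ∷ 2 ∷ [])
  ν⊢N : IsPartitionOf (3 + suc a) (a ∷ 2 ∷ 2 ∷ [])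
  ν⊢N = +-comm a 4 , ≤-trans (s≤s z≤n) 3≤a ∷ s≤s z≤n ∷ s≤s z≤n ∷ [] , ≤-trans (n≤1+n 2) 3≤a ∷ ≤-refl ∷ [-]
  removePart-2 : removePart 2 (a ∷ 2 ∷ 2 ∷ []) ≡ a ∷ 2 ∷ []
  removePart-2 rewrite ≢⇒≡ᵇ-false 2 a (<⇒≢ 3≤a) = refl

theorem4p1 : (n : ℕ) (c d : List ℕ → ℤ) →
    IsEExpansion (lariat n) c → IsEExpansion (pathGraph (3 + n)) d →
    ((λs : List ℕ) → IsPartitionOf (3 + n) λs → c λs ≢ + 0 → d λs ≢ + 0)
    × ((λs : List ℕ) → IsPartitionOf (3 + n) λs → 2 ∉ λs → c λs ≡ + 2 *ℤ d λs)
    × (2 ≤ n → c (suc n ∷ 2 ∷ []) ≡ + (4 * n))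
    × (3 ≤ n → c (n ∷ 2 ∷ 1 ∷ []) ≡ + (2 * (n ∸ 1)))
    × (4 ≤ n → c (n ∸ 1 ∷ 2 ∷ 2 ∷ []) ≡ + (4 * (n ∸ 2)))
theorem4p1 n c d c-expands d-expands =
    lariat-support⊆path-support n c d c-expands d-expands
  , lariat-eCoeff-no-2 n c d c-expands d-expands
  , lariat-eCoeff-[n+1,2] n c c-expands
  , lariat-eCoeff-[n,2,1] n c c-expands
  , lariat-eCoeff-[n-1,2,2] n c c-expands
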